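{- Let $G$ be a simple graph with vertex set $V=V(G)$. Then $$\mathcal{CS}(\mathcal{Z}_G-\varphi_3(V))=\{\varphi_2(X)\cup\varphi_1(\mathsf{odd}_G(X)) : X\in\mathrm{Eul}(G)\}$$ and $$\mathrm{Ort}(\mathcal{Z}_G)=\{\varphi_1(X)\cup\varphi_2(\mathsf{odd}_G(X))\cup\varphi_3(\mathsf{even}_G(X)) : X\in\mathrm{Eul}(G)\}.$$ In particular $|\mathcal{CS}(\mathcal{Z}_G-\varphi_3(V))|=|\mathrm{Ort}(\mathcal{Z}_G)|=|\mathrm{Eul}(G)|$.
   Context: Graphs may have loops but no multiple edges; a simple graph has no loops. The adjacency matrix $A(G)$ is the $V\times V$ matrix over $GF(2)$ with entry $(x,y)$ equal to 1 iff $\{x,y\}$ is an edge. A simple graph is Eulerian if every vertex has even degree (the empty graph is Eulerian); $G[X]$ is the induced subgraph on $X$; $\mathrm{Eul}(G)=\{X\subseteq V: G[X]\text{ Eulerian}\}$. For $X\subseteq V$, $\mathsf{odd}_G(X)$ (resp. $\mathsf{even}_G(X)$) is the set of vertices in $V\setminus X$ adjacent to an odd (resp. even) number of vertices of $X$. Let $\varphi_i(v)=(v,i)$ and $\varphi_i(X)=\{(v,i):v\in X\}$. A carrier is $(U,\Omega)$ with $\Omega$ a partition of finite $U$ into skew classes; transversals meet each class in one element, subtransversals are subsets of transversals. A semi-multimatroid $Z=(U,\Omega,\mathcal{C})$ has circuits $\mathcal{C}$ (subtransversals) such that each $Z[T]=(T,\mathcal{C}\cap 2^T)$, $T$ a transversal,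 is a matroid; $Z$ is sheltered by a matroid $M$ on $U$ if every $Z[T]$ equals the restriction of $M$ to $T$. A multimatroid: no union of two circuits contains exactly one skew pair (2-subset of a skew class); tight: for every subtransversal $S$ with $|S|=|\Omega|-1$ and $\omega$ the class missed by $S$, some $x\in\omega$ makes the circuit families of $Z[S\cup\{x\}]$ and $Z[S]$ differ. $\mathcal{Z}_G$ is the (binary tight) $3$-matroid on $U=V\times\{1,2,3\}$ with skew classes $\{(v,1),(v,2),(v,3)\}$, sheltered by the matroid represented over $GF(2)$ by the matrix whose columns $(v,1),(v,2),(v,3)$ are the $v$-th columns of $I$, $A(G)$, $A(G)+I$. For $X\subseteq U$, $Z-X$ has ground set $U\setminus X$, skew classes the nonempty $\omega\setminus X$, circuits those disjoint from $X$. $\mathrm{Ort}(Z)=\{T \text{ transversal}: Z-T\text{ tight}\}$. The cycle space $\mathcal{CS}(Z)$ is the set of all elements of the cycle spaces (spans of circuits under symmetric difference) of the matroids $Z[T]$, $T$ a transversal. -}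

module Defs where

open import Level using (Level)
open import Data.Nat using (ℕ; zero; suc; _+_; _≤_; _%_; _≡ᵇ_)
open import Data.Bool using (Bool; true; false; _∧_; _∨_; _xor_; not)
open import Data.Fin using (Fin; _≟_)
import Data.Fin as Fin
open import Data.Vec using (Vec; lookup; tabulate; zipWith; replicate)
open import Data.Fin.Subset using (Subset; ∣_∣)
open import Data.Product using (Σ; ∃; ∃-syntax; _×_; _,_)
open import Data.Sum using (_⊎_)
open import Data.List using (List; length)
open import Data.List.Membership.Propositional using (_∈_)
open import Data.List.Relation.Unary.Unique.Propositional using (Unique)
open import Relation.Binary.PropositionalEquality using (_≡_)
open import Relation.Nullary using (¬_)
open import Relation.Nullary.Decidable using (⌊_⌋)
open import Function.Bundles using (_⇔_)

count : ∀ {n} → (Fin n → Bool) → ℕ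
count {zero}  f = 0
count {suc n} f = (if' f Fin.zero) + count (λ i → f (Fin.suc i))
  where
  if' : (Fin (suc n) → Bool) → Fin (suc n) → ℕ
  if' g i with g i
  ... | true  = 1
  ... | false = 0

xorSum : ∀ {n} → (Fin n → Bool) → Bool
xorSum {zero}  f = false
xorSum {suc n} f = f Fin.zero xor xorSum (λ i → f (Fin.suc i))

-- Finite simple graphs on vertex set V = Fin n.
-- adj x y is the (x,y) entry of the adjacency matrix A(G) over GF(2).

record SimpleGraph (n : ℕ) : Set where
  field
    adj        : Fin n → Fin n → Bool
    adj-sym    : ∀ x y → adj x y ≡ adj y x
    adj-irrefl : ∀ x → adj x x ≡ false
open SimpleGraph public

nbrCount : ∀ {n} → SimpleGraph n → Subset n → Fin n → ℕ
nbrCount G X v = count (λ u → lookup X u ∧ adj G v u)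

-- G[X] is Eulerian: every vertex of X has even degree in G[X]
Eulerian : ∀ {n} → SimpleGraph n → Subset n → Set
Eulerian G X = ∀ v → lookup X v ≡ true → nbrCount G X v % 2 ≡ 0

oddG : ∀ {n} → SimpleGraph n → Subset n → Subset n
oddG G X = tabulate (λ v → not (lookup X v) ∧ (nbrCount G X v % 2 ≡ᵇ 1))

evenG : ∀ {n} → SimpleGraph n → Subset n → Subset n
evenG G X = tabulate (λ v → not (lookup X v) ∧ (nbrCount G X v % 2 ≡ᵇ 0))

-- Subsets of U = V × {1,2,3}: a subset is given by its three layers.

data Tag : Set where
  t1 t2 t3 : Tag

record USet (n : ℕ) : Set where
  constructor uset
  field
    p1 p2 p3 : Subset n
open USet public

layer : ∀ {n} → USet n → Tag → Subset n
layer Y t1 = p1 Y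
layer Y t2 = p2 Y
layer Y t3 = p3 Y

memU : ∀ {n} → USet n → Fin n → Tag → Bool
memU Y v t = lookup (layer Y t) v

lift₂ : ∀ {n} → (Bool → Bool → Bool) → USet n → USet n → USet n
lift₂ f Y Z = uset (zipWith f (p1 Y) (p1 Z)) (zipWith f (p2 Y) (p2 Z)) (zipWith f (p3 Y) (p3 Z))

_∪ᵤ_ : ∀ {n} → USet n → USet n → USet n
_∪ᵤ_ = lift₂ _∨_

_∖ᵤ_ : ∀ {n} → USet n → USet n → USet n
_∖ᵤ_ = lift₂ (λ a b → a ∧ not b)

_∆ᵤ_ : ∀ {n} → USet n → USet n → USet n
_∆ᵤ_ = lift₂ _xor_

∅ᵤ : ∀ {n} → USet n
∅ᵤ = uset (replicate _ false) (replicate _ false) (replicate _ false)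

fullᵤ : ∀ {n} → USet n
fullᵤ = uset (replicate _ true) (replicate _ true) (replicate _ true)

singleᵤ : ∀ {n} → Fin n → Tag → USet n
singleᵤ v t = uset (s t1) (s t2) (s t3)
  where
  eqT : Tag → Tag → Bool
  eqT t1 t1 = true
  eqT t2 t2 = true
  eqT t3 t3 = true
  eqT _  _  = false
  s : Tag → Subset _
  s t' = tabulate (λ u → eqT t t' ∧ ⌊ u ≟ v ⌋)

φ : ∀ {n} → Tag → Subset n → USet n
φ t1 X = uset X (replicate _ false) (replicate _ false)
φ t2 X = uset (replicate _ false) X (replicate _ false)
φ t3 X = uset (replicate _ false) (replicate _ false) X

_⊆ᵤ_ : ∀ {n} → USet n → USet n → Set
Y ⊆ᵤ Z = ∀ v t → memU Y v t ≡ true → memU Z v t ≡ true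

_⊂ᵤ_ : ∀ {n} → USet n → USet n → Set
Y ⊂ᵤ Z = Y ⊆ᵤ Z × ¬ (Z ⊆ᵤ Y)

NonemptyU : ∀ {n} → USet n → Set
NonemptyU Y = ∃[ v ] ∃[ t ] memU Y v t ≡ true

DisjointU : ∀ {n} → USet n → USet n → Set
DisjointU Y Z = ∀ v t → memU Y v t ≡ true → memU Z v t ≡ false

sizeU : ∀ {n} → USet n → ℕ
sizeU Y = ∣ p1 Y ∣ + ∣ p2 Y ∣ + ∣ p3 Y ∣

hits : ∀ {n} → USet n → Fin n → ℕ
hits Y v = b (memU Y v t1) + b (memU Y v t2) + b (memU Y v t3)
  where
  b : Bool → ℕ
  b true  = 1
  b false = 0

-- The binary matroid on U represented over GF(2) by the matrix whose
-- columns (v,1),(v,2),(v,3) are the v-th columns of I, A(G), A(G)+I.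

col : ∀ {n} → SimpleGraph n → Fin n → Tag → Fin n → Bool
col G v t1 r = ⌊ r ≟ v ⌋
col G v t2 r = adj G r v
col G v t3 r = adj G r v xor ⌊ r ≟ v ⌋

colSum : ∀ {n} → SimpleGraph n → USet n → Fin n → Bool
colSum G Y r = xorSum (λ v →
  ((memU Y v t1 ∧ col G v t1 r) xor (memU Y v t2 ∧ col G v t2 r))
    xor (memU Y v t3 ∧ col G v t3 r))

DependentM : ∀ {n} → SimpleGraph n → USet n → Set
DependentM G Y = ∃[ Y' ] (Y' ⊆ᵤ Y × NonemptyU Y' × (∀ r → colSum G Y' r ≡ false))

CircuitM : ∀ {n} → SimpleGraph n → USet n → Set
CircuitM G Y = DependentM G Y × (∀ Y' → Y' ⊂ᵤ Y → ¬ DependentM G Y')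

-- Semi-multimatroids over carriers whose ground set is a subset of
-- V × {1,2,3}; the skew classes are the nonempty sets
-- ({v} × {1,2,3}) ∩ ground.

record SMM (n : ℕ) : Set₁ where
  field
    ground  : USet n
    Circuit : USet n → Set
open SMM public

ClassNonempty : ∀ {n} → SMM n → Fin n → Set
ClassNonempty Z v = ∃[ t ] memU (ground Z) v t ≡ true

numClasses : ∀ {n} → SMM n → ℕ
numClasses Z = count (λ v → (memU (ground Z) v t1 ∨ memU (ground Z) v t2) ∨ memU (ground Z) v t3)

Subtransversal : ∀ {n} → SMM n → USet n → Set
Subtransversal Z S = S ⊆ᵤ ground Z × (∀ v → hits S v ≤ 1)

Transversal : ∀ {n} → SMM n → USet n → Set
Transversal Z T = T ⊆ᵤ ground Z × (∀ v → ClassNonempty Z v → hits T v ≡ 1)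

CircuitsOf : ∀ {n} → SMM n → USet n → USet n → Set
CircuitsOf Z S C = Circuit Z C × C ⊆ᵤ S

_−ᵤ_ : ∀ {n} → SMM n → USet n → SMM n
Z −ᵤ X = record
  { ground  = ground Z ∖ᵤ X
  ; Circuit = λ C → Circuit Z C × DisjointU C X }

-- The binary tight 3-matroid Z_G, sheltered by the matroid above:
-- its circuits are the circuits of the matroid that are subtransversals.
Zgraph : ∀ {n} → SimpleGraph n → SMM n
Zgraph G = record
  { ground  = fullᵤ
  ; Circuit = λ C → (C ⊆ᵤ fullᵤ × (∀ v → hits C v ≤ 1)) × CircuitM G C }

data Span {n : ℕ} (P : USet n → Set) : USet n → Set where
  span-∅ : Span P ∅ᵤ
  span-∆ : ∀ {C Y} → P C → Span P Y → Span P (C ∆ᵤ Y)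

CS : ∀ {n} → SMM n → USet n → Set
CS Z Y = ∃[ T ] (Transversal Z T × Span (CircuitsOf Z T) Y)

FamiliesDiffer : ∀ {n} → (USet n → Set) → (USet n → Set) → Set
FamiliesDiffer F H = (∃[ C ] (F C × ¬ H C)) ⊎ (∃[ C ] (H C × ¬ F C))

Tight : ∀ {n} → SMM n → Set
Tight Z = ∀ S → Subtransversal Z S → sizeU S + 1 ≡ numClasses Z →
  ∀ v → ClassNonempty Z v → hits S v ≡ 0 →
  ∃[ t ] (memU (ground Z) v t ≡ true ×
          FamiliesDiffer (CircuitsOf Z (S ∪ᵤ singleᵤ v t)) (CircuitsOf Z S))

Ort : ∀ {n} → SMM n → USet n → Set
Ort Z T = Transversal Z T × Tight (Z −ᵤ T)

HasCard : ∀ {A : Set} → (A → Set) → ℕ → Set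
HasCard {A} P k = Σ (List A) (λ l → Unique l × (∀ x → (x ∈ l) ⇔ P x) × length l ≡ k)

-- Write J ⊆ U through α J = J₁ + J₃ and γ J = J₂ + J₃. Column (v, t) of [I | A | A + I] is e_v,
-- A e_v or their sum, so J is zero-sum exactly when α J = A (γ J). Inside a transversal of
-- Z_G − φ₃(V) this says J₁ = A J₂ with J₁ ∩ J₂ = ∅: X = J₂ is Eulerian and J₁ = odd(X).
-- Conversely such a set is zero-sum inside a transversal, hence a sum of circuits there.
--
-- A transversal T of Z_G lies in Ort(Z_G) exactly when its defect A T₁ + T₂ vanishes; these T
-- are the sets φ₁(X) ∪ φ₂(odd X) ∪ φ₃(even X) with X Eulerian. Since f · A f = 0, the parity of
-- the number of classes whose two columns outside T both pair to 1 with f is f · (A T₁ + T₂).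
-- If the defect vanishes, no functional orthogonal to a subtransversal S can detect both free
-- columns of the class that S misses, so by the Fredholm alternative one of them closes a circuit
-- with S. Conversely, zero-sum sets are isotropic for the symplectic form on GF(2)², which gives
-- Z_G − T an independent transversal R; expanding the defect in the columns of R and using
-- tightness at a class of its support leads to a contradiction.

module Submission where

open import Defs

open import Algebra.Bundles using (CommutativeRing; CommutativeMonoid)
import Algebra.Properties.CommutativeMonoid.Sum as MonoidSum
import Algebra.Properties.CommutativeSemigroup as CommutativeSemigroup
import Algebra.Properties.Semiring.Sum as SemiringSum
open import Data.Bool using (Bool; true; false; _∧_; _∨_; _xor_; not)
import Data.Bool.Properties as Bool
open import Data.Bool.Properties
  using (xor-assoc; xor-comm; xor-same; xor-identityʳ; ∧-distribˡ-xor; ∧-distribʳ-xor;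
         ∧-zeroʳ; ∧-identityʳ; ∧-comm; ∧-assoc; ∨-identityʳ; ∨-zeroʳ)
open import Data.Empty using (⊥; ⊥-elim)
open import Data.Fin using (Fin; _≟_; toℕ)
import Data.Fin as Fin
import Data.Fin.Properties as Fin
open import Data.Fin.Patterns using (0F)
open import Data.Fin.Subset using (Subset; ⊤; ∣_∣)
import Data.Fin.Subset as Subset
open import Data.Fin.Subset.Properties using (anySubset?; p⊆q⇒∣p∣≤∣q∣; p⊂q⇒∣p∣<∣q∣)
open import Data.List using (List; []; _∷_; _++_)
import Data.List as List
open import Data.List.Properties using (length-map)
open import Data.List.Membership.Propositional using (_∈_)
open import Data.List.Membership.Propositional.Properties
  using (∈-map⁺; ∈-map⁻; ∈-++⁺ˡ; ∈-++⁺ʳ; ∈-filter⁺; ∈-filter⁻)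
open import Data.List.Relation.Unary.Any using (here)
import Data.List.Relation.Unary.All as All
import Data.List.Relation.Unary.AllPairs as AllPairs
open import Data.List.Relation.Unary.Unique.Propositional using (Unique)
import Data.List.Relation.Unary.Unique.Propositional.Properties as Unique
open import Data.Nat using (ℕ; zero; suc; _+_; _<_; _≤_; z≤n; s≤s; _%_; _≡ᵇ_)
import Data.Nat as Nat
open import Data.Nat.DivMod using ([m+n]%n≡m%n)
open import Data.Nat.Induction using (<-wellFounded)
import Data.Nat.Properties as Nat
open import Data.Nat.Properties
  using (+-comm; ≤-refl; ≤-trans; ≤-reflexive; +-mono-≤; +-mono-<-≤; +-mono-≤-<; +-0-commutativeMonoid)
open import Data.Product using (∃; ∃-syntax; _×_; _,_; proj₁; proj₂)
import Data.Sum
open import Data.Sum using (_⊎_; inj₁; inj₂; [_,_]′)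
open import Data.Vec using ([]; _∷_; lookup; tabulate)
open import Data.Vec.Functional using (Vector; removeAt)
open import Data.Vec.Properties
  using (lookup∘tabulate; tabulate∘lookup; tabulate-cong; lookup-zipWith; lookup-replicate;
         lookup⇒[]=; []=⇒lookup; ∷-injectiveʳ)
open import Function.Base using (_∘_; case_of_)
open import Function.Bundles using (_⇔_; mk⇔; Equivalence)
open import Induction.WellFounded using (WellFounded; Acc; acc)
import Relation.Binary.Construct.On as On
open import Relation.Binary.PropositionalEquality
  using (_≡_; _≢_; refl; sym; trans; cong; cong₂; subst; subst₂; module ≡-Reasoning)
open import Relation.Nullary using (¬_; Dec; yes; no)
open import Relation.Nullary.Decidable using (⌊_⌋; _→-dec_; _×-dec_; ¬?)

open CommutativeRing Bool.xor-∧-commutativeRing using (semiring; +-commutativeMonoid; +-commutativeSemigroup)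
open MonoidSum +-commutativeMonoid using (sum; ∑-distrib-+; ∑-comm)
open SemiringSum semiring using (*-distribˡ-sum)
open CommutativeSemigroup +-commutativeSemigroup using (interchange)
open CommutativeSemigroup (CommutativeMonoid.commutativeSemigroup Bool.∧-commutativeMonoid)
  using () renaming (x∙yz≈y∙xz to ∧-lcomm)
module ℕ-Sum = MonoidSum +-0-commutativeMonoid

private
  variable
    m n : ℕ

false≢true : false ≢ true
false≢true ()

bit : Bool → ℕ
bit true  = 1
bit false = 0

xor-cancelˡ : ∀ x y → x xor (x xor y) ≡ y
xor-cancelˡ x y = trans (sym (xor-assoc x x y)) (cong (_xor y) (xor-same x))

xor≡false⇒≡ : ∀ {x y} → x xor y ≡ false → x ≡ y
xor≡false⇒≡ {false} {false} _ = refl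
xor≡false⇒≡ {true}  {true}  _ = refl

not∧≡ : ∀ {x y} → (x ≡ true → y ≡ false) → not x ∧ y ≡ y
not∧≡ {true}  x⇒¬y = sym (x⇒¬y refl)
not∧≡ {false} _    = refl

∧≡false : ∀ {x y} → (x ≡ true → y ≡ false) → x ∧ y ≡ false
∧≡false {false} _    = refl
∧≡false {true}  x⇒¬y = x⇒¬y refl

≡⇒xor≡false : ∀ {x y} → x ≡ y → x xor y ≡ false
≡⇒xor≡false {x} refl = xor-same x

xorSum≡sum : (f : Fin n → Bool) → xorSum f ≡ sum f
xorSum≡sum {zero}  f = refl
xorSum≡sum {suc n} f = cong (f 0F xor_) (xorSum≡sum (λ i → f (Fin.suc i)))

xorSum-cong : {f g : Fin n → Bool} → (∀ i → f i ≡ g i) → xorSum f ≡ xorSum g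
xorSum-cong {zero}  e = refl
xorSum-cong {suc n} e = cong₂ _xor_ (e 0F) (xorSum-cong (λ i → e (Fin.suc i)))

xorSum-false : {f : Fin n → Bool} → (∀ i → f i ≡ false) → xorSum f ≡ false
xorSum-false {zero}  e = refl
xorSum-false {suc n} e = cong₂ _xor_ (e 0F) (xorSum-false (λ i → e (Fin.suc i)))

xorSum-xor : (f g : Fin n → Bool) → xorSum (λ i → f i xor g i) ≡ xorSum f xor xorSum g
xorSum-xor f g = begin
  xorSum (λ i → f i xor g i) ≡⟨ xorSum≡sum (λ i → f i xor g i) ⟩
  sum (λ i → f i xor g i)    ≡⟨ ∑-distrib-+ f g ⟩
  sum f xor sum g            ≡⟨ cong₂ _xor_ (xorSum≡sum f) (xorSum≡sum g) ⟨
  xorSum f xor xorSum g      ∎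
  where open ≡-Reasoning

∧-xorSum : ∀ x (f : Fin n → Bool) → x ∧ xorSum f ≡ xorSum (λ i → x ∧ f i)
∧-xorSum x f = begin
  x ∧ xorSum f            ≡⟨ cong (x ∧_) (xorSum≡sum f) ⟩
  x ∧ sum f               ≡⟨ *-distribˡ-sum x f ⟩
  sum (λ i → x ∧ f i)     ≡⟨ xorSum≡sum (λ i → x ∧ f i) ⟨
  xorSum (λ i → x ∧ f i)  ∎
  where open ≡-Reasoning

xorSum-swap : (f : Fin m → Fin n → Bool) →
  xorSum (λ i → xorSum (f i)) ≡ xorSum (λ j → xorSum (λ i → f i j))
xorSum-swap f = begin
  xorSum (λ i → xorSum (f i))            ≡⟨ xorSum-cong (λ i → xorSum≡sum (f i)) ⟩
  xorSum (λ i → sum (f i))               ≡⟨ xorSum≡sum (λ i → sum (f i)) ⟩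
  sum (λ i → sum (f i))                  ≡⟨ ∑-comm f ⟩
  sum (λ j → sum (λ i → f i j))          ≡⟨ xorSum≡sum (λ j → sum (λ i → f i j)) ⟨
  xorSum (λ j → sum (λ i → f i j))       ≡⟨ xorSum-cong (λ j → xorSum≡sum (λ i → f i j)) ⟨
  xorSum (λ j → xorSum (λ i → f i j))    ∎
  where open ≡-Reasoning

xorSum-single : (k : Fin n) (f : Fin n → Bool) → (∀ i → i ≢ k → f i ≡ false) → xorSum f ≡ f k
xorSum-single {suc n} 0F f off =
  trans (cong (f 0F xor_) (xorSum-false (λ i → off (Fin.suc i) λ ()))) (xor-identityʳ _)
xorSum-single {suc n} (Fin.suc k) f off =
  trans (cong (_xor xorSum (λ i → f (Fin.suc i))) (off 0F λ ()))
        (xorSum-single k (λ i → f (Fin.suc i)) (λ i i≢k → off (Fin.suc i) (i≢k ∘ Fin.suc-injective)))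

δ : Fin n → Fin n → Bool
δ u v = ⌊ u ≟ v ⌋

δ-refl : (v : Fin n) → δ v v ≡ true
δ-refl v with v ≟ v
... | yes _   = refl
... | no v≢v = ⊥-elim (v≢v refl)

δ-≢ : {u v : Fin n} → u ≢ v → δ u v ≡ false
δ-≢ {u = u} {v} u≢v with u ≟ v
... | yes u≡v = ⊥-elim (u≢v u≡v)
... | no _    = refl

δ-true : {u v : Fin n} → δ u v ≡ true → u ≡ v
δ-true {u = u} {v} _ with u ≟ v
... | yes u≡v = u≡v

xorSum-δʳ : (f : Fin n → Bool) (v : Fin n) → xorSum (λ u → f u ∧ δ u v) ≡ f v
xorSum-δʳ f v = begin
  xorSum (λ u → f u ∧ δ u v) ≡⟨ xorSum-single v _ (λ u u≢v → trans (cong (f u ∧_) (δ-≢ u≢v)) (∧-zeroʳ (f u))) ⟩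
  f v ∧ δ v v                ≡⟨ cong (f v ∧_) (δ-refl v) ⟩
  f v ∧ true                 ≡⟨ ∧-identityʳ (f v) ⟩
  f v                        ∎
  where open ≡-Reasoning

xorSum-δˡ : (f : Fin n → Bool) (v : Fin n) → xorSum (λ u → f u ∧ δ v u) ≡ f v
xorSum-δˡ f v = trans (xorSum-cong (λ u → cong (f u ∧_) (δ-sym v u))) (xorSum-δʳ f v)
  where
  δ-sym : ∀ u w → δ u w ≡ δ w u
  δ-sym u w with u ≟ w | w ≟ u
  ... | yes _ | yes _ = refl
  ... | no _  | no _  = refl
  ... | yes refl | no w≢u = ⊥-elim (w≢u refl)
  ... | no u≢w | yes refl = ⊥-elim (u≢w refl)

δᵗ : Tag → Tag → Bool
δᵗ t1 t1 = true
δᵗ t2 t2 = true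
δᵗ t3 t3 = true
δᵗ _  _  = false

δᵗ-refl : ∀ t → δᵗ t t ≡ true
δᵗ-refl t1 = refl
δᵗ-refl t2 = refl
δᵗ-refl t3 = refl

δᵗ-≢ : ∀ {s t} → s ≢ t → δᵗ s t ≡ false
δᵗ-≢ {t1} {t1} s≢t = ⊥-elim (s≢t refl)
δᵗ-≢ {t1} {t2} _ = refl
δᵗ-≢ {t1} {t3} _ = refl
δᵗ-≢ {t2} {t1} _ = refl
δᵗ-≢ {t2} {t2} s≢t = ⊥-elim (s≢t refl)
δᵗ-≢ {t2} {t3} _ = refl
δᵗ-≢ {t3} {t1} _ = refl
δᵗ-≢ {t3} {t2} _ = refl
δᵗ-≢ {t3} {t3} s≢t = ⊥-elim (s≢t refl)

δᵗ-true : ∀ {s t} → δᵗ s t ≡ true → s ≡ t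
δᵗ-true {t1} {t1} _ = refl
δᵗ-true {t2} {t2} _ = refl
δᵗ-true {t3} {t3} _ = refl

Indicator : ℕ → Set
Indicator n = Fin n → Tag → Bool

sum₃ : (Tag → Bool) → Bool
sum₃ h = (h t1 xor h t2) xor h t3

sumᵤ : Indicator n → Bool
sumᵤ H = xorSum (λ v → sum₃ (H v))

sum₃-cong : {g h : Tag → Bool} → (∀ t → g t ≡ h t) → sum₃ g ≡ sum₃ h
sum₃-cong e = cong₂ _xor_ (cong₂ _xor_ (e t1) (e t2)) (e t3)

sum₃-xor : (g h : Tag → Bool) → sum₃ (λ t → g t xor h t) ≡ sum₃ g xor sum₃ h
sum₃-xor g h =
  trans (cong (_xor (g t3 xor h t3)) (interchange (g t1) (h t1) (g t2) (h t2)))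
        (interchange (g t1 xor g t2) (h t1 xor h t2) (g t3) (h t3))

∧-sum₃ : ∀ x (h : Tag → Bool) → x ∧ sum₃ h ≡ sum₃ (λ t → x ∧ h t)
∧-sum₃ x h =
  trans (∧-distribˡ-xor x (h t1 xor h t2) (h t3))
        (cong (_xor (x ∧ h t3)) (∧-distribˡ-xor x (h t1) (h t2)))

sum₃-single : (s : Tag) (h : Tag → Bool) → (∀ t → t ≢ s → h t ≡ false) → sum₃ h ≡ h s
sum₃-single t1 h off rewrite off t2 (λ ()) | off t3 (λ ()) = trans (xor-identityʳ _) (xor-identityʳ _)
sum₃-single t2 h off rewrite off t1 (λ ()) | off t3 (λ ()) = xor-identityʳ _
sum₃-single t3 h off rewrite off t1 (λ ()) | off t2 (λ ()) = refl

sumᵤ-cong : {H K : Indicator n} → (∀ v t → H v t ≡ K v t) → sumᵤ H ≡ sumᵤ K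
sumᵤ-cong e = xorSum-cong (λ v → sum₃-cong (e v))

sumᵤ-false : {H : Indicator n} → (∀ v t → H v t ≡ false) → sumᵤ H ≡ false
sumᵤ-false e = xorSum-false (λ v → sum₃-cong (e v))

sumᵤ-xor : (H K : Indicator n) → sumᵤ (λ v t → H v t xor K v t) ≡ sumᵤ H xor sumᵤ K
sumᵤ-xor H K = trans (xorSum-cong (λ v → sum₃-xor (H v) (K v)))
                     (xorSum-xor (λ v → sum₃ (H v)) (λ v → sum₃ (K v)))

∧-sumᵤ : ∀ x (H : Indicator n) → x ∧ sumᵤ H ≡ sumᵤ (λ v t → x ∧ H v t)
∧-sumᵤ x H = trans (∧-xorSum x (λ v → sum₃ (H v))) (xorSum-cong (λ v → ∧-sum₃ x (H v)))

xorSum-sumᵤ-swap : (H : Fin m → Indicator n) →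
  xorSum (λ r → sumᵤ (H r)) ≡ sumᵤ (λ v t → xorSum (λ r → H r v t))
xorSum-sumᵤ-swap H = trans (xorSum-swap (λ r v → sum₃ (H r v))) (xorSum-cong λ v → begin
  xorSum (λ r → sum₃ (H r v))                                           ≡⟨ xorSum-xor (λ r → H r v t1 xor H r v t2) (λ r → H r v t3) ⟩
  xorSum (λ r → H r v t1 xor H r v t2) xor xorSum (λ r → H r v t3)      ≡⟨ cong (_xor xorSum (λ r → H r v t3)) (xorSum-xor (λ r → H r v t1) (λ r → H r v t2)) ⟩
  sum₃ (λ t → xorSum (λ r → H r v t))                                   ∎)
  where open ≡-Reasoning

sumᵤ-single : (k : Fin n) (s : Tag) (H : Indicator n) →
  (∀ v t → ¬ (v ≡ k × t ≡ s) → H v t ≡ false) → sumᵤ H ≡ H k s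
sumᵤ-single k s H off =
  trans (xorSum-single k _ (λ v v≢k → sum₃-cong (λ t → off v t (v≢k ∘ proj₁))))
        (sum₃-single s (H k) (λ t t≢s → off k t (t≢s ∘ proj₂)))

infixl 6 _⊕_
infix 7 _·_

_⊕_ : Vector Bool n → Vector Bool n → Vector Bool n
(f ⊕ g) r = f r xor g r

_·_ : Vector Bool n → Vector Bool n → Bool
f · g = xorSum (λ r → f r ∧ g r)

·-comm : (f g : Vector Bool n) → f · g ≡ g · f
·-comm f g = xorSum-cong (λ r → ∧-comm (f r) (g r))

·-cong : (f : Vector Bool n) {g h : Vector Bool n} → (∀ r → g r ≡ h r) → f · g ≡ f · h
·-cong f e = xorSum-cong (λ r → cong (f r ∧_) (e r))

·-⊕ʳ : (f g h : Vector Bool n) → f · (g ⊕ h) ≡ f · g xor f · h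
·-⊕ʳ f g h = trans (xorSum-cong (λ r → ∧-distribˡ-xor (f r) (g r) (h r)))
                   (xorSum-xor (λ r → f r ∧ g r) (λ r → f r ∧ h r))

·-⊕ˡ : (f g h : Vector Bool n) → (f ⊕ g) · h ≡ f · h xor g · h
·-⊕ˡ f g h = trans (xorSum-cong (λ r → ∧-distribʳ-xor (h r) (f r) (g r)))
                   (xorSum-xor (λ r → f r ∧ h r) (λ r → g r ∧ h r))

δ-· : (k : Fin n) (f : Vector Bool n) → δ k · f ≡ f k
δ-· k f = trans (xorSum-cong (λ r → ∧-comm (δ k r) (f r))) (xorSum-δˡ f k)

detect-both : {P : Vector Bool n → Set} → (∀ {f g} → P f → P g → P (f ⊕ g)) → ∀ c d {f g} →
  P f → f · c ≡ true → P g → g · d ≡ true → ∃[ h ] (P h × h · c ≡ true × h · d ≡ true)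
detect-both P-⊕ c d {f} {g} pf fc pg gd with f · d in fd | g · c in gc
... | true  | _    = f , pf , fc , fd
... | false | true = g , pg , gc , gd
... | false | false = f ⊕ g , P-⊕ pf pg , trans (·-⊕ˡ f g c) (cong₂ _xor_ fc gc) , trans (·-⊕ˡ f g d) (cong₂ _xor_ fd gd)

combine : (Fin m → Tag → Vector Bool n) → Indicator m → Vector Bool n
combine vs J r = sumᵤ (λ v t → J v t ∧ vs v t r)

combine-cong : (vs : Fin m → Tag → Vector Bool n) {J K : Indicator m} →
  (∀ v t → J v t ≡ K v t) → ∀ r → combine vs J r ≡ combine vs K r
combine-cong vs e r = sumᵤ-cong (λ v t → cong (_∧ vs v t r) (e v t))

combine-xor : (vs : Fin m → Tag → Vector Bool n) (J K : Indicator m) →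
  ∀ r → combine vs (λ v t → J v t xor K v t) r ≡ combine vs J r xor combine vs K r
combine-xor vs J K r =
  trans (sumᵤ-cong (λ v t → ∧-distribʳ-xor (vs v t r) (J v t) (K v t)))
        (sumᵤ-xor (λ v t → J v t ∧ vs v t r) (λ v t → K v t ∧ vs v t r))

·-combine : (f : Vector Bool n) (vs : Fin m → Tag → Vector Bool n) (J : Indicator m) →
  f · combine vs J ≡ sumᵤ (λ v t → J v t ∧ f · vs v t)
·-combine f vs J = begin
  xorSum (λ r → f r ∧ sumᵤ (λ v t → J v t ∧ vs v t r))        ≡⟨ xorSum-cong (λ r → ∧-sumᵤ (f r) (λ v t → J v t ∧ vs v t r)) ⟩
  xorSum (λ r → sumᵤ (λ v t → f r ∧ (J v t ∧ vs v t r)))      ≡⟨ xorSum-sumᵤ-swap (λ r v t → f r ∧ (J v t ∧ vs v t r)) ⟩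
  sumᵤ (λ v t → xorSum (λ r → f r ∧ (J v t ∧ vs v t r)))      ≡⟨ sumᵤ-cong (λ v t → xorSum-cong (λ r → ∧-lcomm (f r) (J v t) (vs v t r))) ⟩
  sumᵤ (λ v t → xorSum (λ r → J v t ∧ (f r ∧ vs v t r)))      ≡⟨ sumᵤ-cong (λ v t → ∧-xorSum (J v t) (λ r → f r ∧ vs v t r)) ⟨
  sumᵤ (λ v t → J v t ∧ f · vs v t)                           ∎
  where open ≡-Reasoning

-- The Fredholm alternative over GF(2)

record Alternative (Spanned Annihilates : Vector Bool n → Set) : Set where
  field
    annihilates-⊕ : ∀ {f g} → Annihilates f → Annihilates g → Annihilates (f ⊕ g)
    decide        : ∀ b → Spanned b ⊎ ∃[ f ] (Annihilates f × f · b ≡ true)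

module _ {Sp Ann : Vector Bool n → Set} where

  adjoin : Alternative Sp Ann → (w : Vector Bool n) →
    Alternative (λ b → ∃[ c ] Sp (λ r → (c ∧ w r) xor b r)) (λ f → Ann f × f · w ≡ false)
  adjoin alt w = record
    { annihilates-⊕ = λ (af , fw) (ag , gw) →
        annihilates-⊕ af ag , trans (·-⊕ˡ _ _ w) (cong₂ _xor_ fw gw)
    ; decide = decide′ }
    where
    open Alternative alt
    decide′ : ∀ b → (∃[ c ] Sp (λ r → (c ∧ w r) xor b r)) ⊎ ∃[ f ] ((Ann f × f · w ≡ false) × f · b ≡ true)
    decide′ b with decide b
    ... | inj₁ sp = inj₁ (false , sp)
    ... | inj₂ (f , af , fb) with f · w in fw
    ...   | false = inj₂ (f , (af , fw) , fb)
    ...   | true with decide (w ⊕ b)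
    ...     | inj₁ sp = inj₁ (true , sp)
    ...     | inj₂ (g , ag , g[w⊕b]) with g · w in gw
    ...       | false = inj₂ (g , (ag , gw) , trans (sym (trans (·-⊕ʳ g w b) (cong (_xor g · b) gw))) g[w⊕b])
    ...       | true  = inj₂ (f ⊕ g , (annihilates-⊕ af ag , trans (·-⊕ˡ f g w) (cong₂ _xor_ fw gw))
                                    , trans (·-⊕ˡ f g b) (cong₂ _xor_ fb gb))
      where
      -- g · b = g · (w ⊕ b) + g · w = 1 + 1
      gb : g · b ≡ false
      gb = Bool.not-injective (trans (sym (trans (·-⊕ʳ g w b) (cong (_xor g · b) gw))) g[w⊕b])

Spanned : (Fin m → Tag → Vector Bool n) → Vector Bool n → Set
Spanned vs b = ∃[ J ] (∀ r → combine vs J r ≡ b r)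

Annihilates : (Fin m → Tag → Vector Bool n) → Vector Bool n → Set
Annihilates vs f = ∀ v t → f · vs v t ≡ false

fredholm : (vs : Fin m → Tag → Vector Bool n) → Alternative (Spanned vs) (Annihilates vs)
fredholm {zero} vs = record
  { annihilates-⊕ = λ _ _ ()
  ; decide = λ b → decide-zero b }
  where
  decide-zero : ∀ b → Spanned vs b ⊎ ∃[ f ] (Annihilates vs f × f · b ≡ true)
  decide-zero b with Fin.any? (λ k → b k Bool.≟ true)
  ... | yes (k , bk) = inj₂ (δ k , (λ ()) , trans (δ-· k b) bk)
  ... | no ¬bk = inj₁ ((λ ()) , λ r → sym (Bool.¬-not (λ br → ¬bk (r , br))))
fredholm {suc m} vs = record
  { annihilates-⊕ = λ af ag v t → trans (·-⊕ˡ _ _ (vs v t)) (cong₂ _xor_ (af v t) (ag v t))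
  ; decide        = λ b → Data.Sum.map spanned annihilates (Alternative.decide alt b) }
  where
  w : Tag → Vector Bool _
  w = vs 0F
  rest : Fin m → Tag → Vector Bool _
  rest v = vs (Fin.suc v)
  Spanned₃ : Vector Bool _ → Set
  Spanned₃ b = ∃[ c₃ ] ∃[ c₂ ] ∃[ c₁ ] Spanned rest (λ r → (c₁ ∧ w t1 r) xor ((c₂ ∧ w t2 r) xor ((c₃ ∧ w t3 r) xor b r)))
  Annihilates₃ : Vector Bool _ → Set
  Annihilates₃ f = ((Annihilates rest f × f · w t1 ≡ false) × f · w t2 ≡ false) × f · w t3 ≡ false
  alt : Alternative Spanned₃ Annihilates₃
  alt = adjoin (adjoin (adjoin (fredholm rest) (w t1)) (w t2)) (w t3)
  spanned : ∀ {b} → Spanned₃ b → Spanned vs b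
  spanned {b} (c₃ , c₂ , c₁ , J , e) =
    J′ , λ r → trans (cong (sum₃ (λ t → J′ 0F t ∧ w t r) xor_) (e r))
                     (xor-cancel₃ (c₁ ∧ w t1 r) (c₂ ∧ w t2 r) (c₃ ∧ w t3 r) (b r))
    where
    J′ : Indicator (suc m)
    J′ 0F          t1 = c₁
    J′ 0F          t2 = c₂
    J′ 0F          t3 = c₃
    J′ (Fin.suc v) t  = J v t
    xor-cancel₃ : ∀ x y z a → ((x xor y) xor z) xor (x xor (y xor (z xor a))) ≡ a
    xor-cancel₃ x y z a = trans (cong (((x xor y) xor z) xor_) (begin
      x xor (y xor (z xor a))  ≡⟨ cong (x xor_) (xor-assoc y z a) ⟨
      x xor ((y xor z) xor a)  ≡⟨ xor-assoc x (y xor z) a ⟨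
      (x xor (y xor z)) xor a  ≡⟨ cong (_xor a) (xor-assoc x y z) ⟨
      ((x xor y) xor z) xor a  ∎)) (xor-cancelˡ ((x xor y) xor z) a)
      where open ≡-Reasoning
  annihilates : ∀ {b} → ∃[ f ] (Annihilates₃ f × f · b ≡ true) → ∃[ f ] (Annihilates vs f × f · b ≡ true)
  annihilates (f , (((af , f₁) , f₂) , f₃) , fb) = f , ann , fb
    where
    ann : Annihilates vs f
    ann 0F          t1 = f₁
    ann 0F          t2 = f₂
    ann 0F          t3 = f₃
    ann (Fin.suc v) t  = af v t

Subset-ext : {X Y : Subset n} → (∀ v → lookup X v ≡ lookup Y v) → X ≡ Y
Subset-ext {X = X} {Y} e = trans (sym (tabulate∘lookup X)) (trans (tabulate-cong e) (tabulate∘lookup Y))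

USet-ext : {Y Z : USet n} → (∀ v t → memU Y v t ≡ memU Z v t) → Y ≡ Z
USet-ext {Y = uset a b c} {uset a′ b′ c′} e =
  cong₃ uset (Subset-ext (λ v → e v t1)) (Subset-ext (λ v → e v t2)) (Subset-ext (λ v → e v t3))
  where
  cong₃ : ∀ {A B C D : Set} (f : A → B → C → D) {x x′ y y′ z z′} →
    x ≡ x′ → y ≡ y′ → z ≡ z′ → f x y z ≡ f x′ y′ z′
  cong₃ f refl refl refl = refl

toUSet : Indicator n → USet n
toUSet J = uset (tabulate (λ v → J v t1)) (tabulate (λ v → J v t2)) (tabulate (λ v → J v t3))

memU-toUSet : (J : Indicator n) → ∀ v t → memU (toUSet J) v t ≡ J v t
memU-toUSet J v t1 = lookup∘tabulate _ v
memU-toUSet J v t2 = lookup∘tabulate _ v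
memU-toUSet J v t3 = lookup∘tabulate _ v

memU-lift₂ : ∀ f (Y Z : USet n) v t → memU (lift₂ f Y Z) v t ≡ f (memU Y v t) (memU Z v t)
memU-lift₂ f Y Z v t1 = lookup-zipWith f v (p1 Y) (p1 Z)
memU-lift₂ f Y Z v t2 = lookup-zipWith f v (p2 Y) (p2 Z)
memU-lift₂ f Y Z v t3 = lookup-zipWith f v (p3 Y) (p3 Z)

memU-∅ : ∀ (v : Fin n) t → memU ∅ᵤ v t ≡ false
memU-∅ v t1 = lookup-replicate v false
memU-∅ v t2 = lookup-replicate v false
memU-∅ v t3 = lookup-replicate v false

memU-full : ∀ (v : Fin n) t → memU fullᵤ v t ≡ true
memU-full v t1 = lookup-replicate v true
memU-full v t2 = lookup-replicate v true
memU-full v t3 = lookup-replicate v true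

memU-φ : ∀ s (X : Subset n) v t → memU (φ s X) v t ≡ δᵗ s t ∧ lookup X v
memU-φ t1 X v t1 = refl
memU-φ t1 X v t2 = lookup-replicate v false
memU-φ t1 X v t3 = lookup-replicate v false
memU-φ t2 X v t1 = lookup-replicate v false
memU-φ t2 X v t2 = refl
memU-φ t2 X v t3 = lookup-replicate v false
memU-φ t3 X v t1 = lookup-replicate v false
memU-φ t3 X v t2 = lookup-replicate v false
memU-φ t3 X v t3 = refl

memU-single : ∀ (v : Fin n) s u t → memU (singleᵤ v s) u t ≡ δᵗ s t ∧ δ u v
memU-single v t1 u t1 = lookup∘tabulate _ u
memU-single v t1 u t2 = lookup∘tabulate _ u
memU-single v t1 u t3 = lookup∘tabulate _ u
memU-single v t2 u t1 = lookup∘tabulate _ u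
memU-single v t2 u t2 = lookup∘tabulate _ u
memU-single v t2 u t3 = lookup∘tabulate _ u
memU-single v t3 u t1 = lookup∘tabulate _ u
memU-single v t3 u t2 = lookup∘tabulate _ u
memU-single v t3 u t3 = lookup∘tabulate _ u

⊆ᵤ-refl : {Y : USet n} → Y ⊆ᵤ Y
⊆ᵤ-refl _ _ y = y

⊆ᵤ-trans : {X Y Z : USet n} → X ⊆ᵤ Y → Y ⊆ᵤ Z → X ⊆ᵤ Z
⊆ᵤ-trans X⊆Y Y⊆Z v t x = Y⊆Z v t (X⊆Y v t x)

all-tags? : {P : Tag → Set} → (∀ t → Dec (P t)) → Dec (∀ t → P t)
all-tags? P? with P? t1 | P? t2 | P? t3
... | yes p | yes q | yes r = yes λ { t1 → p ; t2 → q ; t3 → r }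
... | no ¬p | _     | _     = no λ h → ¬p (h t1)
... | yes _ | no ¬q | _     = no λ h → ¬q (h t2)
... | yes _ | yes _ | no ¬r = no λ h → ¬r (h t3)

any-tag? : {P : Tag → Set} → (∀ t → Dec (P t)) → Dec (∃ P)
any-tag? P? with P? t1 | P? t2 | P? t3
... | yes p | _     | _     = yes (t1 , p)
... | no _  | yes q | _     = yes (t2 , q)
... | no _  | no _  | yes r = yes (t3 , r)
... | no ¬p | no ¬q | no ¬r = no λ { (t1 , p) → ¬p p ; (t2 , q) → ¬q q ; (t3 , r) → ¬r r }

_⊆ᵤ?_ : (Y Z : USet n) → Dec (Y ⊆ᵤ Z)
Y ⊆ᵤ? Z = Fin.all? λ v → all-tags? λ t → (memU Y v t Bool.≟ true) →-dec (memU Z v t Bool.≟ true)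

any-USet? : {P : USet n → Set} → (∀ Y → Dec (P Y)) → Dec (∃ P)
any-USet? P? with anySubset? (λ a → anySubset? (λ b → anySubset? (λ c → P? (uset a b c))))
... | yes (a , b , c , p) = yes (uset a b c , p)
... | no ¬p               = no λ { (uset a b c , p) → ¬p (a , b , c , p) }

⊈ᵤ-witness : (Y Z : USet n) → ¬ (Y ⊆ᵤ Z) → ∃[ v ] ∃[ t ] (memU Y v t ≡ true × memU Z v t ≡ false)
⊈ᵤ-witness Y Z Y⊈Z with Fin.any? (λ v → any-tag? λ t → (memU Y v t Bool.≟ true) ×-dec (memU Z v t Bool.≟ false))
... | yes w = w
... | no ¬w = ⊥-elim (Y⊈Z λ v t y → Bool.¬-not λ z → ¬w (v , t , y , z))

_⊏_ : USet n → USet n → Set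
Y ⊏ Z = sizeU Y < sizeU Z

⊏-wellFounded : WellFounded (_⊏_ {n})
⊏-wellFounded = On.wellFounded sizeU <-wellFounded

layer-⊆ : {Y Z : USet n} → Y ⊆ᵤ Z → ∀ t → layer Y t Subset.⊆ layer Z t
layer-⊆ {Z = Z} Y⊆Z t {v} v∈Y = lookup⇒[]= v (layer Z t) (Y⊆Z v t ([]=⇒lookup v∈Y))

layer-≤ : {Y Z : USet n} → Y ⊆ᵤ Z → ∀ t → ∣ layer Y t ∣ ≤ ∣ layer Z t ∣
layer-≤ Y⊆Z t = p⊆q⇒∣p∣≤∣q∣ (layer-⊆ Y⊆Z t)

layer-< : {Y Z : USet n} → Y ⊆ᵤ Z → ∀ v t → memU Y v t ≡ false → memU Z v t ≡ true →
  ∣ layer Y t ∣ < ∣ layer Z t ∣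
layer-< {Z = Z} Y⊆Z v t y z =
  p⊂q⇒∣p∣<∣q∣ (layer-⊆ Y⊆Z t , v , lookup⇒[]= v (layer Z t) z , λ v∈Y → false≢true (trans (sym y) ([]=⇒lookup v∈Y)))

⊆ᵤ-⊏ : {Y Z : USet n} → Y ⊆ᵤ Z → ∀ v t → memU Y v t ≡ false → memU Z v t ≡ true → Y ⊏ Z
⊆ᵤ-⊏ Y⊆Z v t1 y z = +-mono-<-≤ (+-mono-<-≤ (layer-< Y⊆Z v t1 y z) (layer-≤ Y⊆Z t2)) (layer-≤ Y⊆Z t3)
⊆ᵤ-⊏ Y⊆Z v t2 y z = +-mono-<-≤ (+-mono-≤-< (layer-≤ Y⊆Z t1) (layer-< Y⊆Z v t2 y z)) (layer-≤ Y⊆Z t3)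
⊆ᵤ-⊏ Y⊆Z v t3 y z = +-mono-≤-< (+-mono-≤ (layer-≤ Y⊆Z t1) (layer-≤ Y⊆Z t2)) (layer-< Y⊆Z v t3 y z)

count₃ : (Tag → Bool) → ℕ
count₃ h = bit (h t1) + bit (h t2) + bit (h t3)

hits≡count₃ : (Y : USet n) (v : Fin n) → hits Y v ≡ count₃ (memU Y v)
hits≡count₃ Y v with memU Y v t1 | memU Y v t2 | memU Y v t3
... | true  | true  | true  = refl
... | true  | true  | false = refl
... | true  | false | true  = refl
... | true  | false | false = refl
... | false | true  | true  = refl
... | false | true  | false = refl
... | false | false | true  = refl
... | false | false | false = refl

count₃-cong : {g h : Tag → Bool} → (∀ t → g t ≡ h t) → count₃ g ≡ count₃ h
count₃-cong e = cong₂ _+_ (cong₂ _+_ (cong bit (e t1)) (cong bit (e t2))) (cong bit (e t3))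

count₃-mono : {g h : Tag → Bool} → (∀ t → g t ≡ true → h t ≡ true) → count₃ g ≤ count₃ h
count₃-mono g⊆h = +-mono-≤ (+-mono-≤ (bit-mono (g⊆h t1)) (bit-mono (g⊆h t2))) (bit-mono (g⊆h t3))
  where
  bit-mono : ∀ {a b} → (a ≡ true → b ≡ true) → bit a ≤ bit b
  bit-mono {false} _   = z≤n
  bit-mono {true}  a⇒b rewrite a⇒b refl = ≤-refl

count₃-δᵗ : ∀ s → count₃ (δᵗ s) ≡ 1
count₃-δᵗ t1 = refl
count₃-δᵗ t2 = refl
count₃-δᵗ t3 = refl

count₃≡1⇒δᵗ : {h : Tag → Bool} → count₃ h ≡ 1 → ∃[ s ] (∀ t → h t ≡ δᵗ s t)
count₃≡1⇒δᵗ {h} e with h t1 in e1 | h t2 in e2 | h t3 in e3 | e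
... | true  | false | false | _ = t1 , λ { t1 → e1 ; t2 → e2 ; t3 → e3 }
... | false | true  | false | _ = t2 , λ { t1 → e1 ; t2 → e2 ; t3 → e3 }
... | false | false | true  | _ = t3 , λ { t1 → e1 ; t2 → e2 ; t3 → e3 }

count₃≡1⇒unique : {h : Tag → Bool} → count₃ h ≡ 1 → ∀ {s t} → h s ≡ true → h t ≡ true → s ≡ t
count₃≡1⇒unique e {s} {t} hs ht with count₃≡1⇒δᵗ e
... | s₀ , h=δ = trans (sym (δᵗ-true (trans (sym (h=δ s)) hs))) (δᵗ-true (trans (sym (h=δ t)) ht))

count₃≡0⇒false : {h : Tag → Bool} → count₃ h ≡ 0 → ∀ t → h t ≡ false
count₃≡0⇒false {h} e t with h t1 in e1 | h t2 in e2 | h t3 in e3 | e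
... | false | false | false | _ = case t
  where
  case : ∀ t → h t ≡ false
  case t1 = e1
  case t2 = e2
  case t3 = e3

hits≡0⇒∉ : (S : USet n) → ∀ v → hits S v ≡ 0 → ∀ t → memU S v t ≡ false
hits≡0⇒∉ S v e = count₃≡0⇒false {memU S v} (trans (sym (hits≡count₃ S v)) e)

hits≡1⇒δᵗ : (S : USet n) → ∀ v → hits S v ≡ 1 → ∃[ s ] (∀ t → memU S v t ≡ δᵗ s t)
hits≡1⇒δᵗ S v e = count₃≡1⇒δᵗ {memU S v} (trans (sym (hits≡count₃ S v)) e)

hits≡1⇒unique : (S : USet n) → ∀ v → hits S v ≡ 1 → ∀ {s t} → memU S v s ≡ true → memU S v t ≡ true → s ≡ t
hits≡1⇒unique S v e = count₃≡1⇒unique {memU S v} (trans (sym (hits≡count₃ S v)) e)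

hits≡1⇒∈ : (S : USet n) → ∀ v → hits S v ≡ 1 → ∃[ s ] (memU S v s ≡ true)
hits≡1⇒∈ S v e with hits≡1⇒δᵗ S v e
... | s , S=δ = s , trans (S=δ s) (δᵗ-refl s)

Transversalᵤ : USet n → Set
Transversalᵤ T = ∀ v → hits T v ≡ 1

hits-cong : {Y Z : USet n} → ∀ v → (∀ t → memU Y v t ≡ memU Z v t) → hits Y v ≡ hits Z v
hits-cong {Y = Y} {Z} v e = trans (hits≡count₃ Y v) (trans (count₃-cong e) (sym (hits≡count₃ Z v)))

hits-mono : {Y Z : USet n} → Y ⊆ᵤ Z → ∀ v → hits Y v ≤ hits Z v
hits-mono {Y = Y} {Z} Y⊆Z v =
  subst₂ _≤_ (sym (hits≡count₃ Y v)) (sym (hits≡count₃ Z v)) (count₃-mono (Y⊆Z v))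

memU-∪-single : ∀ (S : USet n) v t u s → memU (S ∪ᵤ singleᵤ v t) u s ≡ memU S u s ∨ (δᵗ t s ∧ δ u v)
memU-∪-single S v t u s = trans (memU-lift₂ _∨_ S (singleᵤ v t) u s) (cong (memU S u s ∨_) (memU-single v t u s))

⊆-∪-single : ∀ (S : USet n) v t → S ⊆ᵤ (S ∪ᵤ singleᵤ v t)
⊆-∪-single S v t u s e = trans (memU-∪-single S v t u s) (cong (_∨ (δᵗ t s ∧ δ u v)) e)

∪-single-cases : ∀ (S : USet n) v t {u s} → memU (S ∪ᵤ singleᵤ v t) u s ≡ true →
  memU S u s ≡ true ⊎ (u ≡ v × s ≡ t)
∪-single-cases S v t {u} {s} e with memU S u s | trans (sym (memU-∪-single S v t u s)) e
... | true  | _ = inj₁ refl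
... | false | e′ = inj₂ (δ-true (Bool.∧-conicalʳ _ _ e′) , sym (δᵗ-true (Bool.∧-conicalˡ _ _ e′)))

memU-∪-single-≢ : ∀ (S : USet n) v t {u} → u ≢ v → ∀ s → memU (S ∪ᵤ singleᵤ v t) u s ≡ memU S u s
memU-∪-single-≢ S v t {u} u≢v s = begin
  memU (S ∪ᵤ singleᵤ v t) u s       ≡⟨ memU-∪-single S v t u s ⟩
  memU S u s ∨ (δᵗ t s ∧ δ u v)     ≡⟨ cong (λ d → memU S u s ∨ (δᵗ t s ∧ d)) (δ-≢ u≢v) ⟩
  memU S u s ∨ (δᵗ t s ∧ false)     ≡⟨ cong (memU S u s ∨_) (∧-zeroʳ (δᵗ t s)) ⟩
  memU S u s ∨ false                ≡⟨ ∨-identityʳ (memU S u s) ⟩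
  memU S u s                        ∎
  where open ≡-Reasoning

hits-∪-single-≢ : ∀ (S : USet n) v t {u} → u ≢ v → hits (S ∪ᵤ singleᵤ v t) u ≡ hits S u
hits-∪-single-≢ S v t u≢v = hits-cong _ (memU-∪-single-≢ S v t u≢v)

hits-∪-single-≡ : ∀ (S : USet n) v t → hits S v ≡ 0 → hits (S ∪ᵤ singleᵤ v t) v ≡ 1
hits-∪-single-≡ S v t hSv = trans (hits≡count₃ (S ∪ᵤ singleᵤ v t) v) (trans (count₃-cong at-v) (count₃-δᵗ t))
  where
  at-v : ∀ s → memU (S ∪ᵤ singleᵤ v t) v s ≡ δᵗ t s
  at-v s = trans (memU-∪-single S v t v s)
    (trans (cong₂ (λ a d → a ∨ (δᵗ t s ∧ d)) (hits≡0⇒∉ S v hSv s) (δ-refl v)) (∧-identityʳ (δᵗ t s)))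

hits-∪-single : ∀ (S : USet n) v t → hits S v ≡ 0 → ∀ u → hits S u ≤ 1 → hits (S ∪ᵤ singleᵤ v t) u ≤ 1
hits-∪-single S v t hSv u hSu with u ≟ v
... | no u≢v   = subst (_≤ 1) (sym (hits-∪-single-≢ S v t u≢v)) hSu
... | yes refl = ≤-reflexive (hits-∪-single-≡ S v t hSv)

removeClass : USet n → Fin n → USet n
removeClass R u = toUSet (λ i t → memU R i t ∧ not (δ i u))

removeClass-⊆ : ∀ (R : USet n) u → removeClass R u ⊆ᵤ R
removeClass-⊆ R u i t e =
  Bool.∧-conicalˡ (memU R i t) (not (δ i u)) (trans (sym (memU-toUSet (λ i t → memU R i t ∧ not (δ i u)) i t)) e)

removeClass-≢ : ∀ (R : USet n) u {i} → i ≢ u → ∀ t → memU (removeClass R u) i t ≡ memU R i t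
removeClass-≢ R u {i} i≢u t = trans (memU-toUSet (λ i t → memU R i t ∧ not (δ i u)) i t)
  (trans (cong (λ d → memU R i t ∧ not d) (δ-≢ i≢u)) (∧-identityʳ (memU R i t)))

removeClass-at : ∀ (R : USet n) u t → memU (removeClass R u) u t ≡ false
removeClass-at R u t = trans (memU-toUSet (λ i t → memU R i t ∧ not (δ i u)) u t)
  (trans (cong (λ d → memU R u t ∧ not d) (δ-refl u)) (∧-zeroʳ (memU R u t)))

hits-removeClass-at : ∀ (R : USet n) u → hits (removeClass R u) u ≡ 0
hits-removeClass-at R u = trans (hits≡count₃ (removeClass R u) u) (count₃-cong (removeClass-at R u))

hits-removeClass-≢ : ∀ (R : USet n) u {i} → i ≢ u → hits (removeClass R u) i ≡ hits R i
hits-removeClass-≢ R u i≢u = hits-cong _ (removeClass-≢ R u i≢u)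

-- The representation [I | A | A + I] of the sheltering matroid

α γ : Indicator n → Vector Bool n
α J v = J v t1 xor J v t3
γ J v = J v t2 xor J v t3

xorSum²-alternating : (M : Fin n → Fin n → Bool) → (∀ i j → M i j ≡ M j i) → (∀ i → M i i ≡ false) →
  xorSum (λ i → xorSum (M i)) ≡ false
xorSum²-alternating {zero}  M sym-M diag = refl
xorSum²-alternating {suc n} M sym-M diag = begin
  (M 0F 0F xor row) xor xorSum (λ i → M (S i) 0F xor xorSum (λ j → M (S i) (S j)))
    ≡⟨ cong ((M 0F 0F xor row) xor_) (xorSum-xor (λ i → M (S i) 0F) (λ i → xorSum (λ j → M (S i) (S j)))) ⟩
  (M 0F 0F xor row) xor (xorSum (λ i → M (S i) 0F) xor xorSum (λ i → xorSum (λ j → M (S i) (S j))))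
    ≡⟨ cong₂ (λ d c → (d xor row) xor (c xor inner)) (diag 0F) (xorSum-cong (λ i → sym-M (S i) 0F)) ⟩
  row xor (row xor inner)
    ≡⟨ xor-cancelˡ row inner ⟩
  xorSum (λ i → xorSum (λ j → M (S i) (S j)))
    ≡⟨ xorSum²-alternating (λ i j → M (S i) (S j)) (λ i j → sym-M (S i) (S j)) (λ i → diag (S i)) ⟩
  false ∎
  where
  open ≡-Reasoning
  S : Fin n → Fin (suc n)
  S = Fin.suc
  row inner : Bool
  row = xorSum (λ j → M 0F (S j))
  inner = xorSum (λ i → xorSum (λ j → M (S i) (S j)))

module _ (G : SimpleGraph n) where

  adjSum : Vector Bool n → Vector Bool n
  adjSum f v = xorSum (λ u → f u ∧ adj G v u)

  adjSum-symmetric : (f g : Vector Bool n) → f · adjSum g ≡ adjSum f · g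
  adjSum-symmetric f g = begin
    xorSum (λ v → f v ∧ xorSum (λ u → g u ∧ adj G v u))   ≡⟨ xorSum-cong (λ v → ∧-xorSum (f v) (λ u → g u ∧ adj G v u)) ⟩
    xorSum (λ v → xorSum (λ u → f v ∧ (g u ∧ adj G v u))) ≡⟨ xorSum-swap (λ v u → f v ∧ (g u ∧ adj G v u)) ⟩
    xorSum (λ u → xorSum (λ v → f v ∧ (g u ∧ adj G v u))) ≡⟨ xorSum-cong (λ u → xorSum-cong (λ v → swap-entries u v)) ⟩
    xorSum (λ u → xorSum (λ v → g u ∧ (f v ∧ adj G u v))) ≡⟨ xorSum-cong (λ u → ∧-xorSum (g u) (λ v → f v ∧ adj G u v)) ⟨
    xorSum (λ u → g u ∧ adjSum f u)                       ≡⟨ xorSum-cong (λ u → ∧-comm (g u) (adjSum f u)) ⟩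
    xorSum (λ u → adjSum f u ∧ g u)                       ∎
    where
    open ≡-Reasoning
    swap-entries : ∀ u v → f v ∧ (g u ∧ adj G v u) ≡ g u ∧ (f v ∧ adj G u v)
    swap-entries u v = trans (∧-lcomm (f v) (g u) (adj G v u)) (cong (λ a → g u ∧ (f v ∧ a)) (adj-sym G v u))

  adjSum-alternating : (f : Vector Bool n) → f · adjSum f ≡ false
  adjSum-alternating f = begin
    xorSum (λ v → f v ∧ xorSum (λ u → f u ∧ adj G v u))   ≡⟨ xorSum-cong (λ v → ∧-xorSum (f v) (λ u → f u ∧ adj G v u)) ⟩
    xorSum (λ v → xorSum (λ u → f v ∧ (f u ∧ adj G v u))) ≡⟨ xorSum²-alternating (λ v u → f v ∧ (f u ∧ adj G v u)) sym-entries diag-entries ⟩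
    false                                                 ∎
    where
    open ≡-Reasoning
    sym-entries : ∀ v u → f v ∧ (f u ∧ adj G v u) ≡ f u ∧ (f v ∧ adj G u v)
    sym-entries v u = trans (∧-lcomm (f v) (f u) (adj G v u)) (cong (λ a → f u ∧ (f v ∧ a)) (adj-sym G v u))
    diag-entries : ∀ v → f v ∧ (f v ∧ adj G v v) ≡ false
    diag-entries v = trans (cong (λ a → f v ∧ (f v ∧ a)) (adj-irrefl G v)) (trans (cong (f v ∧_) (∧-zeroʳ (f v))) (∧-zeroʳ (f v)))

  adjSum-cong : {f g : Vector Bool n} → (∀ v → f v ≡ g v) → ∀ r → adjSum f r ≡ adjSum g r
  adjSum-cong e r = xorSum-cong (λ u → cong (_∧ adj G r u) (e u))

  colDot : Vector Bool n → Fin n → Tag → Bool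
  colDot f v t = f · col G v t

  colDot-t1 : ∀ f v → colDot f v t1 ≡ f v
  colDot-t1 f v = xorSum-δʳ f v

  colDot-t2 : ∀ f v → colDot f v t2 ≡ adjSum f v
  colDot-t2 f v = xorSum-cong (λ u → cong (f u ∧_) (adj-sym G u v))

  colDot-t3 : ∀ f v → colDot f v t3 ≡ adjSum f v xor f v
  colDot-t3 f v = trans (·-⊕ʳ f (λ r → adj G r v) (λ r → δ r v)) (cong₂ _xor_ (colDot-t2 f v) (colDot-t1 f v))

  combine-col : (J : Indicator n) → ∀ r → combine (col G) J r ≡ α J r xor adjSum (γ J) r
  combine-col J r = begin
    xorSum (λ v → sum₃ (λ t → J v t ∧ col G v t r))                             ≡⟨ xorSum-cong (λ v → col-mix (J v t1) (J v t2) (J v t3) (adj G r v) (δ r v)) ⟩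
    xorSum (λ v → (α J v ∧ δ r v) xor (γ J v ∧ adj G r v))                      ≡⟨ xorSum-xor (λ v → α J v ∧ δ r v) (λ v → γ J v ∧ adj G r v) ⟩
    xorSum (λ v → α J v ∧ δ r v) xor adjSum (γ J) r                             ≡⟨ cong (_xor adjSum (γ J) r) (xorSum-δˡ (α J) r) ⟩
    α J r xor adjSum (γ J) r                                                    ∎
    where
    open ≡-Reasoning
    col-mix : ∀ j₁ j₂ j₃ a d →
      ((j₁ ∧ d) xor (j₂ ∧ a)) xor (j₃ ∧ (a xor d)) ≡ ((j₁ xor j₃) ∧ d) xor ((j₂ xor j₃) ∧ a)
    col-mix j₁ j₂ j₃ a d = begin
      ((j₁ ∧ d) xor (j₂ ∧ a)) xor (j₃ ∧ (a xor d))       ≡⟨ cong (((j₁ ∧ d) xor (j₂ ∧ a)) xor_) (trans (∧-distribˡ-xor j₃ a d) (xor-comm (j₃ ∧ a) (j₃ ∧ d))) ⟩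
      ((j₁ ∧ d) xor (j₂ ∧ a)) xor ((j₃ ∧ d) xor (j₃ ∧ a)) ≡⟨ interchange (j₁ ∧ d) (j₂ ∧ a) (j₃ ∧ d) (j₃ ∧ a) ⟩
      ((j₁ ∧ d) xor (j₃ ∧ d)) xor ((j₂ ∧ a) xor (j₃ ∧ a)) ≡⟨ cong₂ _xor_ (∧-distribʳ-xor d j₁ j₃) (∧-distribʳ-xor a j₂ j₃) ⟨
      ((j₁ xor j₃) ∧ d) xor ((j₂ xor j₃) ∧ a)             ∎

parity : ℕ → Bool
parity zero    = false
parity (suc k) = not (parity k)

%2≡bit∘parity : ∀ k → k % 2 ≡ bit (parity k)
%2≡bit∘parity zero          = refl
%2≡bit∘parity (suc zero)    = refl
%2≡bit∘parity (suc (suc k)) = begin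
  suc (suc k) % 2       ≡⟨ cong (_% 2) (+-comm 2 k) ⟩
  (k + 2) % 2           ≡⟨ [m+n]%n≡m%n k 2 ⟩
  k % 2                 ≡⟨ %2≡bit∘parity k ⟩
  bit (parity k)        ≡⟨ cong bit (Bool.not-involutive (parity k)) ⟨
  bit (parity (suc (suc k))) ∎
  where open ≡-Reasoning

count-suc : (f : Fin (suc n) → Bool) → count f ≡ bit (f 0F) + count (λ i → f (Fin.suc i))
count-suc f with f 0F
... | true  = refl
... | false = refl

parity∘count : (f : Fin n → Bool) → parity (count f) ≡ xorSum f
parity∘count {zero}  f = refl
parity∘count {suc n} f = trans (cong parity (count-suc f)) (parity-bit+ (f 0F))
  where
  parity-bit+ : ∀ b → parity (bit b + count (λ i → f (Fin.suc i))) ≡ b xor xorSum (λ i → f (Fin.suc i))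
  parity-bit+ true  = cong not (parity∘count (λ i → f (Fin.suc i)))
  parity-bit+ false = parity∘count (λ i → f (Fin.suc i))

count%2 : (f : Fin n → Bool) → count f % 2 ≡ bit (xorSum f)
count%2 f = trans (%2≡bit∘parity (count f)) (cong bit (parity∘count f))

module _ (G : SimpleGraph n) where

  lookup-oddG : ∀ X v → lookup (oddG G X) v ≡ not (lookup X v) ∧ adjSum G (lookup X) v
  lookup-oddG X v = trans (lookup∘tabulate _ v) (cong (not (lookup X v) ∧_)
    (trans (cong (_≡ᵇ 1) (count%2 (λ u → lookup X u ∧ adj G v u))) (bit≡ᵇ1 _)))
    where
    bit≡ᵇ1 : ∀ b → (bit b ≡ᵇ 1) ≡ b
    bit≡ᵇ1 true  = refl
    bit≡ᵇ1 false = refl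

  lookup-evenG : ∀ X v → lookup (evenG G X) v ≡ not (lookup X v) ∧ not (adjSum G (lookup X) v)
  lookup-evenG X v = trans (lookup∘tabulate _ v) (cong (not (lookup X v) ∧_)
    (trans (cong (_≡ᵇ 0) (count%2 (λ u → lookup X u ∧ adj G v u))) (bit≡ᵇ0 _)))
    where
    bit≡ᵇ0 : ∀ b → (bit b ≡ᵇ 0) ≡ not b
    bit≡ᵇ0 true  = refl
    bit≡ᵇ0 false = refl

  Eulerian⇔ : ∀ X → Eulerian G X ⇔ (∀ v → lookup X v ≡ true → adjSum G (lookup X) v ≡ false)
  Eulerian⇔ X = mk⇔
    (λ eul v x → bit≡0⇒ (trans (sym (count%2 (λ u → lookup X u ∧ adj G v u))) (eul v x)))
    (λ h v x → trans (count%2 (λ u → lookup X u ∧ adj G v u)) (cong bit (h v x)))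
    where
    bit≡0⇒ : ∀ {b} → bit b ≡ 0 → b ≡ false
    bit≡0⇒ {false} _ = refl

⊆ᵤ-antisym : {Y Z : USet n} → Y ⊆ᵤ Z → Z ⊆ᵤ Y → Y ≡ Z
⊆ᵤ-antisym {Y = Y} {Z} Y⊆Z Z⊆Y = USet-ext (λ v t → antisym (Y⊆Z v t) (Z⊆Y v t))
  where
  antisym : ∀ {a b} → (a ≡ true → b ≡ true) → (b ≡ true → a ≡ true) → a ≡ b
  antisym {true}  a⇒b _   = sym (a⇒b refl)
  antisym {false} {true}  _ b⇒a = b⇒a refl
  antisym {false} {false} _ _   = refl

∆ᵤ-⊆ : {Y Z T : USet n} → Y ⊆ᵤ T → Z ⊆ᵤ T → (Y ∆ᵤ Z) ⊆ᵤ T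
∆ᵤ-⊆ {Y = Y} {Z} Y⊆T Z⊆T v t e with memU Y v t in y | memU Z v t in z | trans (sym (memU-lift₂ _xor_ Y Z v t)) e
... | true  | _    | _ = Y⊆T v t y
... | false | true | _ = Z⊆T v t z

∆ᵤ-cancelˡ : (C Y : USet n) → C ∆ᵤ (C ∆ᵤ Y) ≡ Y
∆ᵤ-cancelˡ C Y = USet-ext λ v t → begin
  memU (C ∆ᵤ (C ∆ᵤ Y)) v t                ≡⟨ memU-lift₂ _xor_ C (C ∆ᵤ Y) v t ⟩
  memU C v t xor memU (C ∆ᵤ Y) v t        ≡⟨ cong (memU C v t xor_) (memU-lift₂ _xor_ C Y v t) ⟩
  memU C v t xor (memU C v t xor memU Y v t) ≡⟨ xor-cancelˡ (memU C v t) (memU Y v t) ⟩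
  memU Y v t                              ∎
  where open ≡-Reasoning

module _ (G : SimpleGraph n) where

  ZeroSum : USet n → Set
  ZeroSum Y = ∀ r → colSum G Y r ≡ false

  zeroSum? : ∀ Y → Dec (ZeroSum Y)
  zeroSum? Y = Fin.all? (λ r → colSum G Y r Bool.≟ false)

  colSum≡ : ∀ Y r → colSum G Y r ≡ α (memU Y) r xor adjSum G (γ (memU Y)) r
  colSum≡ Y = combine-col G (memU Y)

  zeroSum-∆ : ∀ {Y Z} → ZeroSum Y → ZeroSum Z → ZeroSum (Y ∆ᵤ Z)
  zeroSum-∆ {Y} {Z} zY zZ r = begin
    colSum G (Y ∆ᵤ Z) r                       ≡⟨ combine-cong (col G) (memU-lift₂ _xor_ Y Z) r ⟩
    combine (col G) (λ v t → memU Y v t xor memU Z v t) r ≡⟨ combine-xor (col G) (memU Y) (memU Z) r ⟩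
    colSum G Y r xor colSum G Z r             ≡⟨ cong₂ _xor_ (zY r) (zZ r) ⟩
    false                                     ∎
    where open ≡-Reasoning

  circuit⇒zeroSum : ∀ {C} → CircuitM G C → ZeroSum C
  circuit⇒zeroSum {C} ((Y , Y⊆C , nonempty , zY) , minimal) with C ⊆ᵤ? Y
  ... | yes C⊆Y = λ r → trans (cong (λ Z → colSum G Z r) (⊆ᵤ-antisym C⊆Y Y⊆C)) (zY r)
  ... | no  C⊈Y = ⊥-elim (minimal Y (Y⊆C , C⊈Y) (Y , ⊆ᵤ-refl , nonempty , zY))

  circuit-through : ∀ D v t → ZeroSum D → memU D v t ≡ true →
    ∃[ C ] (CircuitM G C × C ⊆ᵤ D × memU C v t ≡ true)
  circuit-through D v t = go D (⊏-wellFounded D)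
    where
    Smaller : USet n → USet n → Set
    Smaller D D′ = D′ ⊆ᵤ D × ¬ (D ⊆ᵤ D′) × ZeroSum D′ × memU D′ v t ≡ true

    smaller? : ∀ D D′ → Dec (Smaller D D′)
    smaller? D D′ = (D′ ⊆ᵤ? D) ×-dec ¬? (D ⊆ᵤ? D′) ×-dec zeroSum? D′ ×-dec (memU D′ v t Bool.≟ true)

    go : ∀ D → Acc _⊏_ D → ZeroSum D → memU D v t ≡ true →
      ∃[ C ] (CircuitM G C × C ⊆ᵤ D × memU C v t ≡ true)
    go D (acc rec) zD x∈D with any-USet? (smaller? D)
    ... | yes (D′ , D′⊆D , D⊈D′ , zD′ , x∈D′) =
      let (u , s , u∈D , u∉D′) = ⊈ᵤ-witness D D′ D⊈D′
          (C , circuit , C⊆D′ , x∈C) = go D′ (rec (⊆ᵤ-⊏ D′⊆D u s u∉D′ u∈D)) zD′ x∈D′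
      in C , circuit , ⊆ᵤ-trans C⊆D′ D′⊆D , x∈C
    ... | no none = D , ((D , ⊆ᵤ-refl , (v , t , x∈D) , zD) , minimal) , ⊆ᵤ-refl , x∈D
      where
      -- for a zero-sum Z ⊆ Y ⊊ D, either Z or D ∆ Z is a smaller zero-sum set through (v, t)
      minimal : ∀ Y → Y ⊂ᵤ D → ¬ DependentM G Y
      minimal Y (Y⊆D , D⊈Y) (Z , Z⊆Y , (u , s , u∈Z) , zZ) with memU Z v t in x∈Z
      ... | true  = none (Z , ⊆ᵤ-trans Z⊆Y Y⊆D , (λ D⊆Z → D⊈Y (⊆ᵤ-trans D⊆Z Z⊆Y)) , zZ , x∈Z)
      ... | false = none (D ∆ᵤ Z , D∆Z⊆D , D⊈D∆Z , zeroSum-∆ {D} {Z} zD zZ , x∈D∆Z)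
        where
        Z⊆D : Z ⊆ᵤ D
        Z⊆D = ⊆ᵤ-trans Z⊆Y Y⊆D
        D∆Z⊆D : (D ∆ᵤ Z) ⊆ᵤ D
        D∆Z⊆D = ∆ᵤ-⊆ ⊆ᵤ-refl Z⊆D
        D⊈D∆Z : ¬ (D ⊆ᵤ (D ∆ᵤ Z))
        D⊈D∆Z D⊆D∆Z = false≢true (begin
          false                        ≡⟨ xor-same true ⟨
          true xor true                ≡⟨ cong₂ _xor_ (Z⊆D u s u∈Z) u∈Z ⟨
          memU D u s xor memU Z u s    ≡⟨ memU-lift₂ _xor_ D Z u s ⟨
          memU (D ∆ᵤ Z) u s            ≡⟨ D⊆D∆Z u s (Z⊆D u s u∈Z) ⟩
          true                         ∎)
          where open ≡-Reasoning
        x∈D∆Z : memU (D ∆ᵤ Z) v t ≡ true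
        x∈D∆Z = trans (memU-lift₂ _xor_ D Z v t) (cong₂ _xor_ x∈D x∈Z)

  zeroSum-∅ : ZeroSum ∅ᵤ
  zeroSum-∅ r = sumᵤ-false (λ v t → cong (_∧ col G v t r) (memU-∅ v t))

  module _ {T : USet n} {P : USet n → Set} where

    span⇒zeroSum : (∀ {C} → P C → CircuitM G C × C ⊆ᵤ T) → ∀ {Y} → Span P Y → Y ⊆ᵤ T × ZeroSum Y
    span⇒zeroSum _ span-∅ = (λ v t e → ⊥-elim (false≢true (trans (sym (memU-∅ v t)) e))) , zeroSum-∅
    span⇒zeroSum circuit-in-T (span-∆ {C} {Y} pC sp) =
      let (circuit , C⊆T) = circuit-in-T pC
          (Y⊆T , zY)      = span⇒zeroSum circuit-in-T sp
      in ∆ᵤ-⊆ C⊆T Y⊆T , zeroSum-∆ {C} {Y} (circuit⇒zeroSum circuit) zY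

    zeroSum⇒span : (∀ {C} → CircuitM G C → C ⊆ᵤ T → P C) → ∀ Y → Y ⊆ᵤ T → ZeroSum Y → Span P Y
    zeroSum⇒span circuit-in-P Y = go Y (⊏-wellFounded Y)
      where
      go : ∀ Y → Acc _⊏_ Y → Y ⊆ᵤ T → ZeroSum Y → Span P Y
      go Y (acc rec) Y⊆T zY with Fin.any? (λ v → any-tag? (λ t → memU Y v t Bool.≟ true))
      ... | no empty = subst (Span P) (USet-ext λ v t → trans (memU-∅ v t) (sym (Bool.¬-not λ y → empty (v , t , y)))) span-∅
      ... | yes (v , t , x∈Y) =
        let (C , circuit , C⊆Y , x∈C) = circuit-through Y v t zY x∈Y
            Y′⊆Y : (C ∆ᵤ Y) ⊆ᵤ Y
            Y′⊆Y = ∆ᵤ-⊆ C⊆Y ⊆ᵤ-refl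
            x∉Y′ : memU (C ∆ᵤ Y) v t ≡ false
            x∉Y′ = trans (memU-lift₂ _xor_ C Y v t) (cong₂ _xor_ x∈C x∈Y)
        in subst (Span P) (∆ᵤ-cancelˡ C Y)
             (span-∆ (circuit-in-P circuit (⊆ᵤ-trans C⊆Y Y⊆T))
                     (go (C ∆ᵤ Y) (rec (⊆ᵤ-⊏ Y′⊆Y v t x∉Y′ x∈Y)) (⊆ᵤ-trans Y′⊆Y Y⊆T)
                         (zeroSum-∆ {C} {Y} (circuit⇒zeroSum circuit) zY)))

module _ (G : SimpleGraph n) where

  memU-ground-deletion : ∀ R v t → memU (ground (Zgraph G −ᵤ R)) v t ≡ not (memU R v t)
  memU-ground-deletion R v t = trans (memU-lift₂ (λ a b → a ∧ not b) fullᵤ R v t)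
                                     (cong (_∧ not (memU R v t)) (memU-full v t))

  circuit-of-deletion : ∀ R S {C} → (∀ v → hits S v ≤ 1) → DisjointU S R →
    CircuitM G C → C ⊆ᵤ S → Circuit (Zgraph G −ᵤ R) C
  circuit-of-deletion R S hS S∩R=∅ circuit C⊆S =
    (((λ v t _ → memU-full v t) , (λ v → ≤-trans (hits-mono C⊆S v) (hS v))) , circuit) ,
    (λ v t c → S∩R=∅ v t (C⊆S v t c))

  circuitOf⇒circuitM : ∀ {R S C} → CircuitsOf (Zgraph G −ᵤ R) S C → CircuitM G C × C ⊆ᵤ S
  circuitOf⇒circuitM ((((_ , _) , circuit) , _) , C⊆S) = circuit , C⊆S

-- The cycle space of Z_G − φ₃(V)

module CycleSpace (G : SimpleGraph n) where

  Z₁₂ : SMM n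
  Z₁₂ = Zgraph G −ᵤ φ t3 ⊤

  cycleSet : Subset n → USet n
  cycleSet X = φ t2 X ∪ᵤ φ t1 (oddG G X)

  cycleInd : Subset n → Indicator n
  cycleInd X v t1 = not (lookup X v) ∧ adjSum G (lookup X) v
  cycleInd X v t2 = lookup X v
  cycleInd X v t3 = false

  memU-cycleSet : ∀ X v t → memU (cycleSet X) v t ≡ cycleInd X v t
  memU-cycleSet X v t = trans (memU-lift₂ _∨_ (φ t2 X) (φ t1 (oddG G X)) v t)
    (trans (cong₂ _∨_ (memU-φ t2 X v t) (memU-φ t1 (oddG G X) v t)) (by-tag t))
    where
    by-tag : ∀ t → (δᵗ t2 t ∧ lookup X v) ∨ (δᵗ t1 t ∧ lookup (oddG G X) v) ≡ cycleInd X v t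
    by-tag t1 = lookup-oddG G X v
    by-tag t2 = ∨-identityʳ (lookup X v)
    by-tag t3 = refl

  ground-Z₁₂-t3 : ∀ v → memU (ground Z₁₂) v t3 ≡ false
  ground-Z₁₂-t3 v = trans (memU-ground-deletion G (φ t3 ⊤) v t3) (cong not (trans (memU-φ t3 ⊤ v t3) (lookup-replicate v true)))

  ground-Z₁₂-t1 : ∀ v → memU (ground Z₁₂) v t1 ≡ true
  ground-Z₁₂-t1 v = trans (memU-ground-deletion G (φ t3 ⊤) v t1) (cong not (lookup-replicate v false))

  zeroSum⇔ : ∀ Y → (∀ v → memU Y v t3 ≡ false) →
    ZeroSum G Y ⇔ (∀ r → memU Y r t1 ≡ adjSum G (λ v → memU Y v t2) r)
  zeroSum⇔ Y Y₃=∅ = mk⇔ (λ zY r → xor≡false⇒≡ (trans (sym (colSum≡′ r)) (zY r)))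
                        (λ e r → trans (colSum≡′ r) (≡⇒xor≡false (e r)))
    where
    colSum≡′ : ∀ r → colSum G Y r ≡ memU Y r t1 xor adjSum G (λ v → memU Y v t2) r
    colSum≡′ r = trans (colSum≡ G Y r) (cong₂ _xor_
      (trans (cong (memU Y r t1 xor_) (Y₃=∅ r)) (xor-identityʳ (memU Y r t1)))
      (adjSum-cong G (λ v → trans (cong (memU Y v t2 xor_) (Y₃=∅ v)) (xor-identityʳ (memU Y v t2))) r))

  cycleSpace⇒ : ∀ Y → CS Z₁₂ Y → ∃[ X ] (Eulerian G X × Y ≡ cycleSet X)
  cycleSpace⇒ Y (T , (T⊆ground , hT) , span) =
    p2 Y , Eulerian⇔ G (p2 Y) .Equivalence.from eulerian , USet-ext (λ v t → trans (by-tag v t) (sym (memU-cycleSet (p2 Y) v t)))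
    where
    Y⊆T×zY : Y ⊆ᵤ T × ZeroSum G Y
    Y⊆T×zY = span⇒zeroSum G (circuitOf⇒circuitM G) span
    Y⊆T : Y ⊆ᵤ T
    Y⊆T = proj₁ Y⊆T×zY
    Y₃=∅ : ∀ v → memU Y v t3 ≡ false
    Y₃=∅ v = Bool.¬-not λ y → false≢true (trans (sym (ground-Z₁₂-t3 v)) (T⊆ground v t3 (Y⊆T v t3 y)))
    Y₁=AY₂ : ∀ r → memU Y r t1 ≡ adjSum G (lookup (p2 Y)) r
    Y₁=AY₂ = zeroSum⇔ Y Y₃=∅ .Equivalence.to (proj₂ Y⊆T×zY)
    Y₁∧Y₂=∅ : ∀ v → memU Y v t2 ≡ true → memU Y v t1 ≡ false
    Y₁∧Y₂=∅ v y₂ = Bool.¬-not λ y₁ →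
      case hits≡1⇒unique T v (hT v (t1 , ground-Z₁₂-t1 v)) {t1} {t2} (Y⊆T v t1 y₁) (Y⊆T v t2 y₂) of λ ()
    eulerian : ∀ v → lookup (p2 Y) v ≡ true → adjSum G (lookup (p2 Y)) v ≡ false
    eulerian v x = trans (sym (Y₁=AY₂ v)) (Y₁∧Y₂=∅ v x)
    by-tag : ∀ v t → memU Y v t ≡ cycleInd (p2 Y) v t
    by-tag v t1 with memU Y v t2 in y₂
    ... | true  = Y₁∧Y₂=∅ v y₂
    ... | false = Y₁=AY₂ v
    by-tag v t2 = refl
    by-tag v t3 = Y₃=∅ v

  cycleSpace⇐ : ∀ X → Eulerian G X → CS Z₁₂ (cycleSet X)
  cycleSpace⇐ X eul =
    T , (T⊆ground , λ v _ → hT v) ,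
    zeroSum⇒span G (λ circuit C⊆T → circuit-of-deletion G (φ t3 ⊤) T (λ v → ≤-reflexive (hT v)) T∩φ₃=∅ circuit C⊆T , C⊆T)
                   (cycleSet X) cycle⊆T zeroSum
    where
    TInd : Indicator n
    TInd v t1 = not (lookup X v)
    TInd v t2 = lookup X v
    TInd v t3 = false
    T : USet n
    T = toUSet TInd
    T∩φ₃=∅ : DisjointU T (φ t3 ⊤)
    T∩φ₃=∅ v t1 _ = memU-φ t3 ⊤ v t1
    T∩φ₃=∅ v t2 _ = memU-φ t3 ⊤ v t2
    T∩φ₃=∅ v t3 e = ⊥-elim (false≢true (trans (sym (memU-toUSet TInd v t3)) e))
    T⊆ground : T ⊆ᵤ ground Z₁₂
    T⊆ground v t e = trans (memU-ground-deletion G (φ t3 ⊤) v t) (cong not (T∩φ₃=∅ v t e))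
    hT : ∀ v → hits T v ≡ 1
    hT v = trans (hits≡count₃ T v) (trans (count₃-cong (memU-toUSet TInd v)) (one-of-two (lookup X v)))
      where
      one-of-two : ∀ x → bit (not x) + bit x + 0 ≡ 1
      one-of-two true  = refl
      one-of-two false = refl
    cycle⊆T : cycleSet X ⊆ᵤ T
    cycle⊆T v t e = trans (memU-toUSet TInd v t) (by-tag t (trans (sym (memU-cycleSet X v t)) e))
      where
      by-tag : ∀ t → cycleInd X v t ≡ true → TInd v t ≡ true
      by-tag t1 e = Bool.∧-conicalˡ _ _ e
      by-tag t2 e = e
    zeroSum : ZeroSum G (cycleSet X)
    zeroSum = zeroSum⇔ (cycleSet X) (λ v → memU-cycleSet X v t3) .Equivalence.from λ r → begin
      memU (cycleSet X) r t1                             ≡⟨ memU-cycleSet X r t1 ⟩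
      not (lookup X r) ∧ adjSum G (lookup X) r           ≡⟨ not∧≡ (Eulerian⇔ G X .Equivalence.to eul r) ⟩
      adjSum G (lookup X) r                              ≡⟨ adjSum-cong G (λ v → memU-cycleSet X v t2) r ⟨
      adjSum G (λ v → memU (cycleSet X) v t2) r          ∎
      where open ≡-Reasoning

  cycleSet-injective : ∀ {X Y} → cycleSet X ≡ cycleSet Y → X ≡ Y
  cycleSet-injective {X} {Y} e =
    Subset-ext λ v → trans (sym (memU-cycleSet X v t2)) (trans (cong (λ Z → memU Z v t2) e) (memU-cycleSet Y v t2))

  cycleSpace : ∀ Y → CS Z₁₂ Y ⇔ (∃[ X ] (Eulerian G X × Y ≡ cycleSet X))
  cycleSpace Y = mk⇔ (cycleSpace⇒ Y) λ { (X , eul , refl) → cycleSpace⇐ X eul }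

∑ℕ : Vector ℕ n → ℕ
∑ℕ = ℕ-Sum.sum

∑ℕ-ones : ∀ n → ∑ℕ {n} (λ _ → 1) ≡ n
∑ℕ-ones zero    = refl
∑ℕ-ones (suc n) = cong suc (∑ℕ-ones n)

∑ℕ-≤ : (f : Vector ℕ n) → (∀ i → f i ≤ 1) → ∑ℕ f ≤ n
∑ℕ-≤ {zero}  f f≤1 = z≤n
∑ℕ-≤ {suc n} f f≤1 = +-mono-≤ (f≤1 0F) (∑ℕ-≤ (λ i → f (Fin.suc i)) (λ i → f≤1 (Fin.suc i)))

∑ℕ≡n⇒ones : (f : Vector ℕ n) → (∀ i → f i ≤ 1) → ∑ℕ f ≡ n → ∀ i → f i ≡ 1
∑ℕ≡n⇒ones {suc n} f f≤1 e i with f 0F in f₀ | f≤1 0F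
... | zero  | _ = ⊥-elim (Nat.≤⇒≯ (∑ℕ-≤ (λ i → f (Fin.suc i)) (λ i → f≤1 (Fin.suc i))) (≤-reflexive (sym e)))
... | suc zero | _ with i
...   | 0F        = f₀
...   | Fin.suc i = ∑ℕ≡n⇒ones (λ i → f (Fin.suc i)) (λ i → f≤1 (Fin.suc i)) (Nat.suc-injective e) i
∑ℕ≡n⇒ones {suc n} f f≤1 e i | suc (suc _) | s≤s ()

∑ℕ-missing-one⇒ : (f : Vector ℕ n) → (∀ i → f i ≤ 1) → ∀ v → f v ≡ 0 → ∑ℕ f + 1 ≡ n → ∀ u → v ≢ u → f u ≡ 1
∑ℕ-missing-one⇒ {suc n} f f≤1 v fv e u v≢u =
  trans (cong f (sym (Fin.punchIn-punchOut v≢u)))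
        (∑ℕ≡n⇒ones (removeAt f v) (λ i → f≤1 (Fin.punchIn v i)) rest (Fin.punchOut v≢u))
  where
  rest : ∑ℕ (removeAt f v) ≡ n
  rest = Nat.suc-injective (begin
    suc (∑ℕ (removeAt f v))      ≡⟨ +-comm 1 (∑ℕ (removeAt f v)) ⟩
    ∑ℕ (removeAt f v) + 1        ≡⟨ cong (λ x → x + ∑ℕ (removeAt f v) + 1) fv ⟨
    f v + ∑ℕ (removeAt f v) + 1  ≡⟨ cong (_+ 1) (ℕ-Sum.sum-remove f) ⟨
    ∑ℕ f + 1                     ≡⟨ e ⟩
    suc n                        ∎)
    where open ≡-Reasoning

∑ℕ-missing-one⇐ : (f : Vector ℕ n) → ∀ v → f v ≡ 0 → (∀ u → v ≢ u → f u ≡ 1) → ∑ℕ f + 1 ≡ n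
∑ℕ-missing-one⇐ {suc n} f v fv others = begin
  ∑ℕ f + 1                     ≡⟨ cong (_+ 1) (ℕ-Sum.sum-remove f) ⟩
  f v + ∑ℕ (removeAt f v) + 1  ≡⟨ cong (λ x → x + ∑ℕ (removeAt f v) + 1) fv ⟩
  ∑ℕ (removeAt f v) + 1        ≡⟨ cong (_+ 1) (ℕ-Sum.sum-cong-≗ (λ i → others (Fin.punchIn v i) (Fin.punchInᵢ≢i v i ∘ sym))) ⟩
  ∑ℕ {n} (λ _ → 1) + 1         ≡⟨ cong (_+ 1) (∑ℕ-ones n) ⟩
  n + 1                        ≡⟨ +-comm n 1 ⟩
  suc n                        ∎
  where open ≡-Reasoning

∣∣≡∑ℕ : (p : Subset n) → ∣ p ∣ ≡ ∑ℕ (λ v → bit (lookup p v))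
∣∣≡∑ℕ []          = refl
∣∣≡∑ℕ (true ∷ p)  = cong suc (∣∣≡∑ℕ p)
∣∣≡∑ℕ (false ∷ p) = ∣∣≡∑ℕ p

sizeU≡∑hits : (S : USet n) → sizeU S ≡ ∑ℕ (hits S)
sizeU≡∑hits S = begin
  ∣ p1 S ∣ + ∣ p2 S ∣ + ∣ p3 S ∣                             ≡⟨ cong₂ _+_ (cong₂ _+_ (∣∣≡∑ℕ (p1 S)) (∣∣≡∑ℕ (p2 S))) (∣∣≡∑ℕ (p3 S)) ⟩
  ∑ℕ (bitAt t1) + ∑ℕ (bitAt t2) + ∑ℕ (bitAt t3)            ≡⟨ cong (_+ ∑ℕ (bitAt t3)) (ℕ-Sum.∑-distrib-+ (bitAt t1) (bitAt t2)) ⟨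
  ∑ℕ (λ v → bitAt t1 v + bitAt t2 v) + ∑ℕ (bitAt t3)       ≡⟨ ℕ-Sum.∑-distrib-+ (λ v → bitAt t1 v + bitAt t2 v) (bitAt t3) ⟨
  ∑ℕ (λ v → count₃ (memU S v))                             ≡⟨ ℕ-Sum.sum-cong-≗ (λ v → hits≡count₃ S v) ⟨
  ∑ℕ (hits S)                                              ∎
  where
  open ≡-Reasoning
  bitAt : Tag → Vector ℕ _
  bitAt t v = bit (memU S v t)

count-true : (f : Fin n → Bool) → (∀ i → f i ≡ true) → count f ≡ n
count-true {zero}  f _   = refl
count-true {suc n} f all = trans (count-suc f) (cong₂ _+_ (cong bit (all 0F)) (count-true (λ i → f (Fin.suc i)) (λ i → all (Fin.suc i))))

module _ (G : SimpleGraph n) where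

  colsOf : USet n → Fin n → Tag → Vector Bool n
  colsOf S u t r = memU S u t ∧ col G u t r

  Orthogonal : USet n → Vector Bool n → Set
  Orthogonal S f = ∀ u t → memU S u t ≡ true → colDot G f u t ≡ false

  ·-colsOf : ∀ S f u t → f · colsOf S u t ≡ memU S u t ∧ colDot G f u t
  ·-colsOf S f u t = trans (xorSum-cong (λ r → ∧-lcomm (f r) (memU S u t) (col G u t r)))
                           (sym (∧-xorSum (memU S u t) (λ r → f r ∧ col G u t r)))

  annihilates⇒orthogonal : ∀ {S f} → Annihilates (colsOf S) f → Orthogonal S f
  annihilates⇒orthogonal {S} {f} ann u t x =
    trans (sym (trans (·-colsOf S f u t) (cong (_∧ colDot G f u t) x))) (ann u t)

  orthogonal-⊕ : ∀ {S f g} → Orthogonal S f → Orthogonal S g → Orthogonal S (f ⊕ g)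
  orthogonal-⊕ {f = f} {g} of og u t x = trans (·-⊕ˡ f g (col G u t)) (cong₂ _xor_ (of u t x) (og u t x))

  ·-colSum-single : ∀ f Y u s → (∀ i t → memU Y i t ≡ true → ¬ (i ≡ u × t ≡ s) → colDot G f i t ≡ false) →
    f · colSum G Y ≡ memU Y u s ∧ colDot G f u s
  ·-colSum-single f Y u s others = trans (·-combine f (col G) (memU Y)) (sumᵤ-single u s _ off)
    where
    off : ∀ i t → ¬ (i ≡ u × t ≡ s) → memU Y i t ∧ colDot G f i t ≡ false
    off i t ≢ with memU Y i t in y
    ... | true  = others i t y ≢
    ... | false = refl

  zeroSum⇒· : ∀ Y f → ZeroSum G Y → f · colSum G Y ≡ false
  zeroSum⇒· Y f zY = xorSum-false (λ r → trans (cong (f r ∧_) (zY r)) (∧-zeroʳ (f r)))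

  orthogonal-zeroSum : ∀ {S f D v t} → Orthogonal S f → ZeroSum G D → D ⊆ᵤ (S ∪ᵤ singleᵤ v t) →
    colDot G f v t ≡ true → memU D v t ≡ false
  orthogonal-zeroSum {S} {f} {D} {v} {t} of zD D⊆S+x fx = begin
    memU D v t                    ≡⟨ ∧-identityʳ (memU D v t) ⟨
    memU D v t ∧ true             ≡⟨ cong (memU D v t ∧_) fx ⟨
    memU D v t ∧ colDot G f v t   ≡⟨ ·-colSum-single f D v t others ⟨
    f · colSum G D                ≡⟨ zeroSum⇒· D f zD ⟩
    false                         ∎
    where
    open ≡-Reasoning
    others : ∀ i s → memU D i s ≡ true → ¬ (i ≡ v × s ≡ t) → colDot G f i s ≡ false
    others i s d ≢ with ∪-single-cases S v t (D⊆S+x i s d)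
    ... | inj₁ x = of i s x
    ... | inj₂ x = ⊥-elim (≢ x)

  withColumn : USet n → Indicator n → Fin n → Tag → Indicator n
  withColumn S J v t u s = (memU S u s ∧ J u s) xor (δ u v ∧ δᵗ t s)

  zeroSum-withColumn : ∀ S J v t → (∀ r → combine (colsOf S) J r ≡ col G v t r) →
    ZeroSum G (toUSet (withColumn S J v t))
  zeroSum-withColumn S J v t spans r = begin
    colSum G (toUSet (withColumn S J v t)) r
      ≡⟨ combine-cong (col G) (memU-toUSet (withColumn S J v t)) r ⟩
    combine (col G) (withColumn S J v t) r
      ≡⟨ combine-xor (col G) (λ u s → memU S u s ∧ J u s) (λ u s → δ u v ∧ δᵗ t s) r ⟩
    combine (col G) (λ u s → memU S u s ∧ J u s) r xor combine (col G) (λ u s → δ u v ∧ δᵗ t s) r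
      ≡⟨ cong₂ _xor_ (trans (sumᵤ-cong (λ u s → rearrange (memU S u s) (J u s) (col G u s r))) (spans r))
                     (sumᵤ-single v t _ off) ⟩
    col G v t r xor ((δ v v ∧ δᵗ t t) ∧ col G v t r)
      ≡⟨ cong (λ x → col G v t r xor (x ∧ col G v t r)) (cong₂ _∧_ (δ-refl v) (δᵗ-refl t)) ⟩
    col G v t r xor col G v t r
      ≡⟨ xor-same (col G v t r) ⟩
    false ∎
    where
    open ≡-Reasoning
    rearrange : ∀ a j c → (a ∧ j) ∧ c ≡ j ∧ (a ∧ c)
    rearrange a j c = trans (∧-assoc a j c) (∧-lcomm a j c)
    off : ∀ u s → ¬ (u ≡ v × s ≡ t) → (δ u v ∧ δᵗ t s) ∧ col G u s r ≡ false
    off u s ≢ with u ≟ v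
    ... | no _     = refl
    ... | yes refl = cong (_∧ col G u s r) (δᵗ-≢ λ t≡s → ≢ (refl , sym t≡s))

  withColumn-⊆ : ∀ S J v t → toUSet (withColumn S J v t) ⊆ᵤ (S ∪ᵤ singleᵤ v t)
  withColumn-⊆ S J v t u s e =
    trans (memU-∪-single S v t u s) (xor-split (memU S u s) (J u s) (δ u v) (δᵗ t s) (trans (sym (memU-toUSet (withColumn S J v t) u s)) e))
    where
    xor-split : ∀ a j x y → (a ∧ j) xor (x ∧ y) ≡ true → a ∨ (y ∧ x) ≡ true
    xor-split true  _ _ _ _ = refl
    xor-split false _ x y e = trans (∧-comm y x) e

  withColumn-here : ∀ S J v t → memU S v t ≡ false → memU (toUSet (withColumn S J v t)) v t ≡ true
  withColumn-here S J v t v∉S =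
    trans (memU-toUSet (withColumn S J v t) v t)
          (trans (cong₂ (λ a d → (a ∧ J v t) xor (d ∧ δᵗ t t)) v∉S (δ-refl v)) (δᵗ-refl t))

  spanned⇒zeroSum : ∀ {S v t} → memU S v t ≡ false → Spanned (colsOf S) (col G v t) →
    ∃[ D ] (ZeroSum G D × D ⊆ᵤ (S ∪ᵤ singleᵤ v t) × memU D v t ≡ true)
  spanned⇒zeroSum {S} {v} {t} v∉S (J , spans) =
    toUSet (withColumn S J v t) , zeroSum-withColumn S J v t spans , withColumn-⊆ S J v t , withColumn-here S J v t v∉S

  spanned-or-separator : ∀ S v t →
    Spanned (colsOf S) (col G v t) ⊎ ∃[ f ] (Orthogonal S f × colDot G f v t ≡ true)
  spanned-or-separator S v t = Data.Sum.map₂ (λ (f , ann , fx) → f , annihilates⇒orthogonal ann , fx)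
                                             (Alternative.decide (fredholm (colsOf S)) (col G v t))

  newCircuit-or-separator : ∀ S v t → memU S v t ≡ false →
    (∃[ C ] (CircuitM G C × C ⊆ᵤ (S ∪ᵤ singleᵤ v t) × memU C v t ≡ true)) ⊎
    (∃[ f ] (Orthogonal S f × colDot G f v t ≡ true))
  newCircuit-or-separator S v t v∉S = Data.Sum.map₁ new-circuit (spanned-or-separator S v t)
    where
    new-circuit : Spanned (colsOf S) (col G v t) → ∃[ C ] (CircuitM G C × C ⊆ᵤ (S ∪ᵤ singleᵤ v t) × memU C v t ≡ true)
    new-circuit spanned =
      let (D , zD , D⊆S+x , x∈D)     = spanned⇒zeroSum v∉S spanned
          (C , circuit , C⊆D , x∈C) = circuit-through G D v t zD x∈D
      in C , circuit , ⊆ᵤ-trans C⊆D D⊆S+x , x∈C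

-- The symplectic form on GF(2)² in the coordinates α, γ

ω₃ : (Tag → Bool) → (Tag → Bool) → Bool
ω₃ a b = ((a t1 xor a t3) ∧ (b t2 xor b t3)) xor ((a t2 xor a t3) ∧ (b t1 xor b t3))

ω₃-cong : ∀ {a a′ b b′} → (∀ t → a t ≡ a′ t) → (∀ t → b t ≡ b′ t) → ω₃ a b ≡ ω₃ a′ b′
ω₃-cong ea eb = cong₂ _xor_
  (cong₂ _∧_ (cong₂ _xor_ (ea t1) (ea t3)) (cong₂ _xor_ (eb t2) (eb t3)))
  (cong₂ _∧_ (cong₂ _xor_ (ea t2) (ea t3)) (cong₂ _xor_ (eb t1) (eb t3)))

ω₃-δᵗ : ∀ {p q} → p ≢ q → ω₃ (δᵗ p) (δᵗ q) ≡ true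
ω₃-δᵗ {t1} {t1} p≢q = ⊥-elim (p≢q refl)
ω₃-δᵗ {t1} {t2} _ = refl
ω₃-δᵗ {t1} {t3} _ = refl
ω₃-δᵗ {t2} {t1} _ = refl
ω₃-δᵗ {t2} {t2} p≢q = ⊥-elim (p≢q refl)
ω₃-δᵗ {t2} {t3} _ = refl
ω₃-δᵗ {t3} {t1} _ = refl
ω₃-δᵗ {t3} {t2} _ = refl
ω₃-δᵗ {t3} {t3} p≢q = ⊥-elim (p≢q refl)

-- ω₃ is alternating, hence vanishes on two multiples of one vector
ω₃-within-one : (r j k : Tag → Bool) → count₃ r ≤ 1 → ω₃ (λ t → r t ∧ j t) (λ t → r t ∧ k t) ≡ false
ω₃-within-one r j k r≤1 with r t1 | r t2 | r t3 | r≤1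
... | false | false | false | _ = refl
... | true  | false | false | _ with j t1 | k t1
...   | true  | true  = refl
...   | true  | false = refl
...   | false | _     = refl
ω₃-within-one r j k r≤1 | false | true | false | _ with j t2 | k t2
...   | true  | true  = refl
...   | true  | false = refl
...   | false | _     = refl
ω₃-within-one r j k r≤1 | false | false | true | _ with j t3 | k t3
...   | true  | true  = refl
...   | true  | false = refl
...   | false | _     = refl
ω₃-within-one r j k r≤1 | true  | true  | _    | s≤s ()
ω₃-within-one r j k r≤1 | true  | false | true | s≤s ()
ω₃-within-one r j k r≤1 | false | true  | true | s≤s ()

module _ (G : SimpleGraph n) where

  zeroSum-isotropic : ∀ D₁ D₂ → ZeroSum G D₁ → ZeroSum G D₂ → xorSum (λ v → ω₃ (memU D₁ v) (memU D₂ v)) ≡ false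
  zeroSum-isotropic D₁ D₂ z₁ z₂ = begin
    xorSum (λ v → ω₃ (memU D₁ v) (memU D₂ v))
      ≡⟨ xorSum-xor (λ v → α (memU D₁) v ∧ γ₂ v) (λ v → γ₁ v ∧ α (memU D₂) v) ⟩
    α (memU D₁) · γ₂ xor γ₁ · α (memU D₂)
      ≡⟨ cong₂ _xor_ (xorSum-cong (λ v → cong (_∧ γ₂ v) (α≡Aγ D₁ z₁ v))) (·-cong γ₁ (α≡Aγ D₂ z₂)) ⟩
    adjSum G γ₁ · γ₂ xor γ₁ · adjSum G γ₂
      ≡⟨ cong (adjSum G γ₁ · γ₂ xor_) (adjSum-symmetric G γ₁ γ₂) ⟩
    adjSum G γ₁ · γ₂ xor adjSum G γ₁ · γ₂
      ≡⟨ xor-same (adjSum G γ₁ · γ₂) ⟩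
    false ∎
    where
    open ≡-Reasoning
    γ₁ γ₂ : Vector Bool n
    γ₁ = γ (memU D₁)
    γ₂ = γ (memU D₂)
    α≡Aγ : ∀ D → ZeroSum G D → ∀ v → α (memU D) v ≡ adjSum G (γ (memU D)) v
    α≡Aγ D zD v = xor≡false⇒≡ (trans (sym (colSum≡ G D v)) (zD v))

module _ (G : SimpleGraph n) where

  Independent : USet n → Set
  Independent R = ∀ D → D ⊆ᵤ R → ZeroSum G D → ∀ v t → memU D v t ≡ false

  independent-∪-single : ∀ R w t {f} → Independent R → Orthogonal G R f → colDot G f w t ≡ true →
    Independent (R ∪ᵤ singleᵤ w t)
  independent-∪-single R w t {f} ind of fx D D⊆R+x zD = ind D D⊆R zD
    where
    x∉D : memU D w t ≡ false
    x∉D = orthogonal-zeroSum G of zD D⊆R+x fx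
    D⊆R : D ⊆ᵤ R
    D⊆R u s d with ∪-single-cases R w t {u} {s} (D⊆R+x u s d)
    ... | inj₁ u∈R           = u∈R
    ... | inj₂ (refl , refl) = ⊥-elim (false≢true (trans (sym x∉D) d))

  -- both spans give zero-sum sets, and ω₃ (δᵗ p) (δᵗ q) = 1 at w contradicts their isotropy
  ¬spanned-both : ∀ R w {p q} → (∀ u → hits R u ≤ 1) → hits R w ≡ 0 → p ≢ q →
    Spanned (colsOf G R) (col G w p) → Spanned (colsOf G R) (col G w q) → ⊥
  ¬spanned-both R w {p} {q} hR hRw p≢q (J , spansJ) (K , spansK) = false≢true (begin
    false                                           ≡⟨ zeroSum-isotropic G D₁ D₂ (zeroSum-withColumn G R J w p spansJ) (zeroSum-withColumn G R K w q spansK) ⟨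
    xorSum (λ v → ω₃ (memU D₁ v) (memU D₂ v))       ≡⟨ xorSum-single w _ off-w ⟩
    ω₃ (memU D₁ w) (memU D₂ w)                      ≡⟨ ω₃-cong (at-w J p) (at-w K q) ⟩
    ω₃ (δᵗ p) (δᵗ q)                                ≡⟨ ω₃-δᵗ p≢q ⟩
    true                                            ∎)
    where
    open ≡-Reasoning
    D₁ D₂ : USet n
    D₁ = toUSet (withColumn G R J w p)
    D₂ = toUSet (withColumn G R K w q)
    off : ∀ L s {u} → u ≢ w → ∀ t → memU (toUSet (withColumn G R L w s)) u t ≡ memU R u t ∧ L u t
    off L s {u} u≢w t = trans (memU-toUSet (withColumn G R L w s) u t)
      (trans (cong (λ d → (memU R u t ∧ L u t) xor (d ∧ δᵗ s t)) (δ-≢ u≢w)) (xor-identityʳ (memU R u t ∧ L u t)))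
    at-w : ∀ L s t → memU (toUSet (withColumn G R L w s)) w t ≡ δᵗ s t
    at-w L s t = trans (memU-toUSet (withColumn G R L w s) w t)
      (cong₂ (λ a d → (a ∧ L w t) xor (d ∧ δᵗ s t)) (hits≡0⇒∉ R w hRw t) (δ-refl w))
    off-w : ∀ u → u ≢ w → ω₃ (memU D₁ u) (memU D₂ u) ≡ false
    off-w u u≢w = trans (ω₃-cong (off J p u≢w) (off K q u≢w))
      (ω₃-within-one (memU R u) (J u) (K u) (subst (_≤ 1) (hits≡count₃ R u) (hR u)))

all₃ : (Tag → Bool) → Bool
all₃ h = (h t1 ∧ h t2) ∧ h t3

all₃-false : ∀ h s → h s ≡ false → all₃ h ≡ false
all₃-false h t1 e rewrite e = refl
all₃-false h t2 e rewrite e = cong (_∧ h t3) (∧-zeroʳ (h t1))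
all₃-false h t3 e rewrite e = ∧-zeroʳ (h t1 ∧ h t2)

all₃⇔ : ∀ h → all₃ h ≡ true ⇔ (∀ t → h t ≡ true)
all₃⇔ h = mk⇔ (λ e → λ { t1 → Bool.∧-conicalˡ (h t1) (h t2) (Bool.∧-conicalˡ (h t1 ∧ h t2) (h t3) e)
                          ; t2 → Bool.∧-conicalʳ (h t1) (h t2) (Bool.∧-conicalˡ (h t1 ∧ h t2) (h t3) e)
                          ; t3 → Bool.∧-conicalʳ (h t1 ∧ h t2) (h t3) e })
                (λ all → cong₂ _∧_ (cong₂ _∧_ (all t1) (all t2)) (all t3))

allFreeOne-δᵗ : ∀ s x y → ((δᵗ s t1 ∨ x) ∧ (δᵗ s t2 ∨ y)) ∧ (δᵗ s t3 ∨ (y xor x))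
                     ≡ ((x ∧ y) xor (δᵗ s t1 ∧ y)) xor (δᵗ s t2 ∧ x)
allFreeOne-δᵗ t1 true  true  = refl
allFreeOne-δᵗ t1 true  false = refl
allFreeOne-δᵗ t1 false true  = refl
allFreeOne-δᵗ t1 false false = refl
allFreeOne-δᵗ t2 true  true  = refl
allFreeOne-δᵗ t2 true  false = refl
allFreeOne-δᵗ t2 false true  = refl
allFreeOne-δᵗ t2 false false = refl
allFreeOne-δᵗ t3 true  true  = refl
allFreeOne-δᵗ t3 true  false = refl
allFreeOne-δᵗ t3 false true  = refl
allFreeOne-δᵗ t3 false false = refl

module _ (G : SimpleGraph n) where

  defect : USet n → Vector Bool n
  defect T r = adjSum G (λ v → memU T v t1) r xor memU T r t2

  allFreeOne : USet n → Vector Bool n → Fin n → Bool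
  allFreeOne T f u = all₃ (λ t → memU T u t ∨ colDot G f u t)

  xorSum-allFreeOne : ∀ T → Transversalᵤ T → ∀ f → xorSum (allFreeOne T f) ≡ f · defect T
  xorSum-allFreeOne T hT f = begin
    xorSum (allFreeOne T f)
      ≡⟨ xorSum-cong (λ u → per-vertex u (hits≡1⇒δᵗ T u (hT u))) ⟩
    xorSum (λ u → ((f u ∧ Af u) xor (T₁ u ∧ Af u)) xor (T₂ u ∧ f u))
      ≡⟨ trans (xorSum-xor (λ u → (f u ∧ Af u) xor (T₁ u ∧ Af u)) (λ u → T₂ u ∧ f u))
               (cong (_xor T₂ · f) (xorSum-xor (λ u → f u ∧ Af u) (λ u → T₁ u ∧ Af u))) ⟩
    (f · Af xor T₁ · Af) xor T₂ · f
      ≡⟨ cong₂ (λ x y → (x xor y) xor T₂ · f) (adjSum-alternating G f) (adjSum-symmetric G T₁ f) ⟩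
    adjSum G T₁ · f xor T₂ · f
      ≡⟨ cong₂ _xor_ (·-comm (adjSum G T₁) f) (·-comm T₂ f) ⟩
    f · adjSum G T₁ xor f · T₂
      ≡⟨ ·-⊕ʳ f (adjSum G T₁) T₂ ⟨
    f · defect T ∎
    where
    open ≡-Reasoning
    Af : Vector Bool n
    Af = adjSum G f
    T₁ T₂ : Vector Bool n
    T₁ v = memU T v t1
    T₂ v = memU T v t2
    per-vertex : ∀ u → ∃[ s ] (∀ t → memU T u t ≡ δᵗ s t) →
      allFreeOne T f u ≡ ((f u ∧ Af u) xor (T₁ u ∧ Af u)) xor (T₂ u ∧ f u)
    per-vertex u (s , T=δ) = begin
      allFreeOne T f u
        ≡⟨ cong₂ _∧_ (cong₂ _∧_ (cong₂ _∨_ (T=δ t1) (colDot-t1 G f u)) (cong₂ _∨_ (T=δ t2) (colDot-t2 G f u)))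
                     (cong₂ _∨_ (T=δ t3) (colDot-t3 G f u)) ⟩
      ((δᵗ s t1 ∨ f u) ∧ (δᵗ s t2 ∨ Af u)) ∧ (δᵗ s t3 ∨ (Af u xor f u))
        ≡⟨ allFreeOne-δᵗ s (f u) (Af u) ⟩
      ((f u ∧ Af u) xor (δᵗ s t1 ∧ Af u)) xor (δᵗ s t2 ∧ f u)
        ≡⟨ cong₂ (λ a b → ((f u ∧ Af u) xor (a ∧ Af u)) xor (b ∧ f u)) (T=δ t1) (T=δ t2) ⟨
      ((f u ∧ Af u) xor (T₁ u ∧ Af u)) xor (T₂ u ∧ f u) ∎

-- Tightness of Z_G − T

module Tightness (G : SimpleGraph n) {T : USet n} (hT : Transversalᵤ T) where

  Zᵀ : SMM n
  Zᵀ = Zgraph G −ᵤ T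

  FreePair : Fin n → Tag → Tag → Set
  FreePair v p q = p ≢ q × memU T v p ≡ false × memU T v q ≡ false × (∀ t → memU T v t ≡ false → t ≡ p ⊎ t ≡ q)

  free-tags : ∀ v → ∃[ p ] ∃[ q ] FreePair v p q
  free-tags v with hits≡1⇒δᵗ T v (hT v)
  ... | t1 , T=δ = t2 , t3 , (λ ()) , T=δ t2 , T=δ t3 , λ { t1 e → ⊥-elim (false≢true (trans (sym e) (T=δ t1))) ; t2 _ → inj₁ refl ; t3 _ → inj₂ refl }
  ... | t2 , T=δ = t1 , t3 , (λ ()) , T=δ t1 , T=δ t3 , λ { t2 e → ⊥-elim (false≢true (trans (sym e) (T=δ t2))) ; t1 _ → inj₁ refl ; t3 _ → inj₂ refl }
  ... | t3 , T=δ = t1 , t2 , (λ ()) , T=δ t1 , T=δ t2 , λ { t3 e → ⊥-elim (false≢true (trans (sym e) (T=δ t3))) ; t1 _ → inj₁ refl ; t2 _ → inj₂ refl }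

  numClasses-Zᵀ : numClasses Zᵀ ≡ n
  numClasses-Zᵀ = count-true _ λ v → some-free v (hits≡1⇒δᵗ T v (hT v))
    where
    some-free : ∀ v → ∃[ s ] (∀ t → memU T v t ≡ δᵗ s t) →
      (memU (ground Zᵀ) v t1 ∨ memU (ground Zᵀ) v t2) ∨ memU (ground Zᵀ) v t3 ≡ true
    some-free v (s , T=δ) rewrite memU-ground-deletion G T v t1 | memU-ground-deletion G T v t2
                                | memU-ground-deletion G T v t3 | T=δ t1 | T=δ t2 | T=δ t3 with s
    ... | t1 = refl
    ... | t2 = refl
    ... | t3 = refl

  ⊆ground⇒disjoint : ∀ {S} → S ⊆ᵤ ground Zᵀ → DisjointU S T
  ⊆ground⇒disjoint S⊆ground v t x = Bool.not-injective (trans (sym (memU-ground-deletion G T v t)) (S⊆ground v t x))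

  allFreeOne⇔ : ∀ f v → allFreeOne G T f v ≡ true ⇔ (∀ t → memU T v t ≡ false → colDot G f v t ≡ true)
  allFreeOne⇔ f v = mk⇔
    (λ e t Tvt → trans (sym (cong (_∨ colDot G f v t) Tvt)) (all₃⇔ (λ t → memU T v t ∨ colDot G f v t) .Equivalence.to e t))
    (λ free → all₃⇔ (λ t → memU T v t ∨ colDot G f v t) .Equivalence.from λ t → or-free t (free t))
    where
    or-free : ∀ t → (memU T v t ≡ false → colDot G f v t ≡ true) → memU T v t ∨ colDot G f v t ≡ true
    or-free t h with memU T v t
    ... | true  = refl
    ... | false = h refl

  -- every class other than that of v carries an element of S, at which f pairs to zero
  xorSum-allFreeOne-at : ∀ {S f} v → Orthogonal G S f → DisjointU S T → (∀ u → v ≢ u → hits S u ≡ 1) →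
    xorSum (allFreeOne G T f) ≡ allFreeOne G T f v
  xorSum-allFreeOne-at {S} {f} v of S∩T=∅ hS = xorSum-single v _ λ u u≢v →
    let (s , u∈S) = hits≡1⇒∈ S u (hS u (u≢v ∘ sym))
    in all₃-false (λ t → memU T u t ∨ colDot G f u t) s (cong₂ _∨_ (S∩T=∅ u s u∈S) (of u s u∈S))

  defect≡0⇒¬allFreeOne : (∀ r → defect G T r ≡ false) → ∀ {S f} v → Orthogonal G S f → DisjointU S T →
    (∀ u → v ≢ u → hits S u ≡ 1) → allFreeOne G T f v ≡ false
  defect≡0⇒¬allFreeOne z {S} {f} v of S∩T=∅ hS = begin
    allFreeOne G T f v           ≡⟨ xorSum-allFreeOne-at v of S∩T=∅ hS ⟨
    xorSum (allFreeOne G T f)    ≡⟨ xorSum-allFreeOne G T hT f ⟩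
    f · defect G T               ≡⟨ xorSum-false (λ r → trans (cong (f r ∧_) (z r)) (∧-zeroʳ (f r))) ⟩
    false                        ∎
    where open ≡-Reasoning

  defect≡0⇒tight : (∀ r → defect G T r ≡ false) → Tight Zᵀ
  defect≡0⇒tight z S (S⊆ground , hS) size v _ hSv = choose (free-tags v)
    where
    S∩T=∅ : DisjointU S T
    S∩T=∅ = ⊆ground⇒disjoint S⊆ground
    hS≡1 : ∀ u → v ≢ u → hits S u ≡ 1
    hS≡1 = ∑ℕ-missing-one⇒ (hits S) hS v hSv (trans (cong (_+ 1) (sym (sizeU≡∑hits S))) (trans size numClasses-Zᵀ))
    Differ : Tag → Set
    Differ t = FamiliesDiffer (CircuitsOf Zᵀ (S ∪ᵤ singleᵤ v t)) (CircuitsOf Zᵀ S)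
    Separated : Tag → Set
    Separated t = ∃[ f ] (Orthogonal G S f × colDot G f v t ≡ true)
    differ : ∀ t → memU T v t ≡ false → ∃[ C ] (CircuitM G C × C ⊆ᵤ (S ∪ᵤ singleᵤ v t) × memU C v t ≡ true) → Differ t
    differ t Tvt (C , circuit , C⊆S+x , x∈C) =
      inj₁ (C , (circuit-of-deletion G T (S ∪ᵤ singleᵤ v t) (λ u → hits-∪-single S v t hSv u (hS u)) S+x∩T=∅ circuit C⊆S+x , C⊆S+x) ,
            λ (_ , C⊆S) → false≢true (trans (sym (hits≡0⇒∉ S v hSv t)) (C⊆S v t x∈C)))
      where
      S+x∩T=∅ : DisjointU (S ∪ᵤ singleᵤ v t) T
      S+x∩T=∅ u s e = [ S∩T=∅ u s , (λ { (refl , refl) → Tvt }) ]′ (∪-single-cases S v t {u} {s} e)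
    attempt : ∀ t → memU T v t ≡ false → Differ t ⊎ Separated t
    attempt t Tvt = Data.Sum.map₁ (differ t Tvt) (newCircuit-or-separator G S v t (hits≡0⇒∉ S v hSv t))
    ground-free : ∀ t → memU T v t ≡ false → memU (ground Zᵀ) v t ≡ true
    ground-free t Tvt = trans (memU-ground-deletion G T v t) (cong not Tvt)
    choose : ∃[ p ] ∃[ q ] FreePair v p q → ∃[ t ] (memU (ground Zᵀ) v t ≡ true × Differ t)
    choose (p , q , _ , Tp , Tq , exhaustive) =
      [ (λ d → p , ground-free p Tp , d)
      , (λ sep-p → [ (λ d → q , ground-free q Tq , d) , (λ sep-q → ⊥-elim (not-both sep-p sep-q)) ]′ (attempt q Tq))
      ]′ (attempt p Tp)
      where
      not-both : Separated p → Separated q → ⊥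
      not-both (f , of , fp) (g , og , gq) =
        let (h , oh , hp , hq) = detect-both (orthogonal-⊕ G) (col G v p) (col G v q) of fp og gq
        in false≢true (trans (sym (defect≡0⇒¬allFreeOne z v oh S∩T=∅ hS≡1))
             (allFreeOne⇔ h v .Equivalence.from λ t Tvt → [ (λ { refl → hp }) , (λ { refl → hq }) ]′ (exhaustive t Tvt)))
  record PartialBasis (m : ℕ) : Set where
    field
      basis       : USet n
      disjoint    : DisjointU basis T
      covered     : ∀ v → toℕ v < m → hits basis v ≡ 1
      uncovered   : ∀ v → m ≤ toℕ v → hits basis v ≡ 0
      independent : Independent G basis

  emptyBasis : PartialBasis 0
  emptyBasis = record
    { basis       = ∅ᵤ
    ; disjoint    = λ v t e → ⊥-elim (false≢true (trans (sym (memU-∅ v t)) e))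
    ; covered     = λ v ()
    ; uncovered   = λ v _ → trans (hits≡count₃ ∅ᵤ v) (count₃-cong (memU-∅ v))
    ; independent = λ D D⊆∅ _ v t → Bool.¬-not λ d → false≢true (trans (sym (memU-∅ v t)) (D⊆∅ v t d)) }

  -- one of the two free columns of the next class is not spanned by the basis so far
  extendBasis : ∀ {m} → m < n → PartialBasis m → PartialBasis (suc m)
  extendBasis {m} m<n B = choose (free-tags w)
    where
    open PartialBasis B
    w : Fin n
    w = Fin.fromℕ< m<n
    toℕw≡m : toℕ w ≡ m
    toℕw≡m = Fin.toℕ-fromℕ< m<n
    hRw : hits basis w ≡ 0
    hRw = uncovered w (≤-reflexive (sym toℕw≡m))
    hR≤1 : ∀ u → hits basis u ≤ 1
    hR≤1 u with toℕ u Nat.<? m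
    ... | yes u<m = ≤-reflexive (covered u u<m)
    ... | no  u≮m = subst (_≤ 1) (sym (uncovered u (Nat.≮⇒≥ u≮m))) z≤n
    add : ∀ {f} t → memU T w t ≡ false → Orthogonal G basis f → colDot G f w t ≡ true → PartialBasis (suc m)
    add t Twt of fx = record
      { basis       = basis ∪ᵤ singleᵤ w t
      ; disjoint    = λ u s e → [ disjoint u s , (λ { (refl , refl) → Twt }) ]′ (∪-single-cases basis w t {u} {s} e)
      ; covered     = covered′
      ; uncovered   = λ u m<u → trans (hits-∪-single-≢ basis w t (λ { refl → Nat.<-irrefl (sym toℕw≡m) m<u }))
                                      (uncovered u (Nat.<⇒≤ m<u))
      ; independent = independent-∪-single G basis w t independent of fx }
      where
      covered′ : ∀ u → toℕ u < suc m → hits (basis ∪ᵤ singleᵤ w t) u ≡ 1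
      covered′ u u<1+m with Nat.m≤n⇒m<n∨m≡n (Nat.≤-pred u<1+m)
      ... | inj₁ u<m = trans (hits-∪-single-≢ basis w t (λ { refl → Nat.<-irrefl toℕw≡m u<m })) (covered u u<m)
      ... | inj₂ u≡m with Fin.toℕ-injective {i = u} {j = w} (trans u≡m (sym toℕw≡m))
      ...   | refl = hits-∪-single-≡ basis w t hRw

    choose : ∃[ p ] ∃[ q ] FreePair w p q → PartialBasis (suc m)
    choose (p , q , p≢q , Tp , Tq , _) with spanned-or-separator G basis w p | spanned-or-separator G basis w q
    ... | inj₂ (f , of , fp) | _                  = add p Tp of fp
    ... | inj₁ _             | inj₂ (g , og , gq) = add q Tq og gq
    ... | inj₁ spanned-p     | inj₁ spanned-q     = ⊥-elim (¬spanned-both G basis w hR≤1 hRw p≢q spanned-p spanned-q)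

  partialBasis : ∀ m → m ≤ n → PartialBasis m
  partialBasis zero    _     = emptyBasis
  partialBasis (suc m) 1+m≤n = extendBasis 1+m≤n (partialBasis m (Nat.<⇒≤ 1+m≤n))

  fullBasis : ∃[ R ] (DisjointU R T × Transversalᵤ R × Independent G R)
  fullBasis = basis , disjoint , (λ v → covered v (Fin.toℕ<n v)) , independent
    where open PartialBasis (partialBasis n ≤-refl)

  familiesDiffer⇒newCircuit : ∀ {S v t} → FamiliesDiffer (CircuitsOf Zᵀ (S ∪ᵤ singleᵤ v t)) (CircuitsOf Zᵀ S) →
    ∃[ C ] (CircuitM G C × C ⊆ᵤ (S ∪ᵤ singleᵤ v t) × ¬ (C ⊆ᵤ S))
  familiesDiffer⇒newCircuit (inj₁ (C , (circuit , C⊆S+x) , C∉S)) =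
    C , proj₂ (proj₁ circuit) , C⊆S+x , λ C⊆S → C∉S (circuit , C⊆S)
  familiesDiffer⇒newCircuit {S} {v} {t} (inj₂ (C , (circuit , C⊆S) , C∉S+x)) =
    ⊥-elim (C∉S+x (circuit , ⊆ᵤ-trans C⊆S (⊆-∪-single S v t)))

  ¬differ : ∀ {S f u t} → Orthogonal G S f → allFreeOne G T f u ≡ true → memU (ground Zᵀ) u t ≡ true →
    ¬ FamiliesDiffer (CircuitsOf Zᵀ (S ∪ᵤ singleᵤ u t)) (CircuitsOf Zᵀ S)
  ¬differ {S} {f} {u} {t} of allOne u∈ground differ with familiesDiffer⇒newCircuit differ
  ... | C , circuit , C⊆S+x , C⊈S = C⊈S C⊆S
    where
    x∉C : memU C u t ≡ false
    x∉C = orthogonal-zeroSum G of (circuit⇒zeroSum G circuit) C⊆S+x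
            (allFreeOne⇔ f u .Equivalence.to allOne t (⊆ground⇒disjoint ⊆ᵤ-refl u t u∈ground))
    C⊆S : C ⊆ᵤ S
    C⊆S i s c with ∪-single-cases S u t {i} {s} (C⊆S+x i s c)
    ... | inj₁ i∈S           = i∈S
    ... | inj₂ (refl , refl) = ⊥-elim (false≢true (trans (sym x∉C) c))

  tight-at : Tight Zᵀ → ∀ R u → DisjointU R T → Transversalᵤ R →
    ∃[ t ] (memU (ground Zᵀ) u t ≡ true ×
            FamiliesDiffer (CircuitsOf Zᵀ (removeClass R u ∪ᵤ singleᵤ u t)) (CircuitsOf Zᵀ (removeClass R u)))
  tight-at tight R u R∩T=∅ hR = tight S (S⊆ground , hS≤1) size u class-u (hits-removeClass-at R u)
    where
    S : USet n
    S = removeClass R u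
    S⊆ground : S ⊆ᵤ ground Zᵀ
    S⊆ground i t e = trans (memU-ground-deletion G T i t) (cong not (R∩T=∅ i t (removeClass-⊆ R u i t e)))
    hS≤1 : ∀ i → hits S i ≤ 1
    hS≤1 i = ≤-trans (hits-mono (removeClass-⊆ R u) i) (≤-reflexive (hR i))
    size : sizeU S + 1 ≡ numClasses Zᵀ
    size = trans (cong (_+ 1) (sizeU≡∑hits S))
                 (trans (∑ℕ-missing-one⇐ (hits S) u (hits-removeClass-at R u) (λ i u≢i → trans (hits-removeClass-≢ R u (u≢i ∘ sym)) (hR i)))
                        (sym numClasses-Zᵀ))
    class-u : ClassNonempty Zᵀ u
    class-u with free-tags u
    ... | p , _ , _ , Tp , _ = p , trans (memU-ground-deletion G T u p) (cong not Tp)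

  defect-support⇒¬tight : Tight Zᵀ → ∀ R J → DisjointU R T → Transversalᵤ R → Independent G R →
    (∀ r → combine (colsOf G R) J r ≡ defect G T r) → ∀ u t₀ → memU R u t₀ ∧ J u t₀ ≡ true → ⊥
  defect-support⇒¬tight tight R J R∩T=∅ hR ind spans u t₀ hit =
    [ new-circuit , separator ]′ (newCircuit-or-separator G S u t₀ (removeClass-at R u t₀))
    where
    S : USet n
    S = removeClass R u
    u∈R : memU R u t₀ ≡ true
    u∈R = Bool.∧-conicalˡ (memU R u t₀) (J u t₀) hit
    new-circuit : ∃[ C ] (CircuitM G C × C ⊆ᵤ (S ∪ᵤ singleᵤ u t₀) × memU C u t₀ ≡ true) → ⊥
    new-circuit (C , circuit , C⊆S+x , x∈C) = false≢true (trans (sym (ind C C⊆R (circuit⇒zeroSum G circuit) u t₀)) x∈C)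
      where
      C⊆R : C ⊆ᵤ R
      C⊆R i t c with ∪-single-cases S u t₀ {i} {t} (C⊆S+x i t c)
      ... | inj₁ i∈S           = removeClass-⊆ R u i t i∈S
      ... | inj₂ (refl , refl) = u∈R
    separator : ∃[ f ] (Orthogonal G S f × colDot G f u t₀ ≡ true) → ⊥
    separator (f , of , fx) with tight-at tight R u R∩T=∅ hR
    ... | t , t∈ground , differ = ¬differ of allOne t∈ground differ
      where
      open ≡-Reasoning
      vanish : ∀ i t → ¬ (i ≡ u × t ≡ t₀) → memU R i t ≡ true → colDot G f i t ≡ false
      vanish i t ≢ i∈R with i ≟ u
      ... | no i≢u   = of i t (trans (removeClass-≢ R u i≢u t) i∈R)
      ... | yes refl = ⊥-elim (≢ (refl , hits≡1⇒unique R u (hR u) i∈R u∈R))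
      off : ∀ i t → ¬ (i ≡ u × t ≡ t₀) → J i t ∧ f · colsOf G R i t ≡ false
      off i t ≢ = trans (cong (J i t ∧_) (trans (·-colsOf G R f i t) (∧≡false (vanish i t ≢)))) (∧-zeroʳ (J i t))
      f·defect : f · defect G T ≡ true
      f·defect = begin
        f · defect G T                               ≡⟨ ·-cong f (λ r → sym (spans r)) ⟩
        f · combine (colsOf G R) J                   ≡⟨ ·-combine f (colsOf G R) J ⟩
        sumᵤ (λ i t → J i t ∧ f · colsOf G R i t)    ≡⟨ sumᵤ-single u t₀ _ off ⟩
        J u t₀ ∧ f · colsOf G R u t₀                 ≡⟨ cong (J u t₀ ∧_) (·-colsOf G R f u t₀) ⟩
        J u t₀ ∧ (memU R u t₀ ∧ colDot G f u t₀)     ≡⟨ cong₂ (λ a b → J u t₀ ∧ (a ∧ b)) u∈R fx ⟩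
        J u t₀ ∧ true                                ≡⟨ ∧-identityʳ (J u t₀) ⟩
        J u t₀                                       ≡⟨ Bool.∧-conicalʳ (memU R u t₀) (J u t₀) hit ⟩
        true                                         ∎
      allOne : allFreeOne G T f u ≡ true
      allOne = trans (sym (xorSum-allFreeOne-at u of (λ i t e → R∩T=∅ i t (removeClass-⊆ R u i t e))
                                                    (λ i u≢i → trans (hits-removeClass-≢ R u (u≢i ∘ sym)) (hR i))))
                     (trans (xorSum-allFreeOne G T hT f) f·defect)

  tight⇒defect≡0 : Tight Zᵀ → ∀ r → defect G T r ≡ false
  tight⇒defect≡0 tight = from-basis fullBasis
    where
    from-basis : ∃[ R ] (DisjointU R T × Transversalᵤ R × Independent G R) → ∀ r → defect G T r ≡ false
    from-basis (R , R∩T=∅ , hR , ind) =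
      [ spanned , separated ]′ (Alternative.decide (fredholm (colsOf G R)) (defect G T))
      where
      open ≡-Reasoning
      separated : ∃[ f ] (Annihilates (colsOf G R) f × f · defect G T ≡ true) → ∀ r → defect G T r ≡ false
      separated (f , ann , fz) = ⊥-elim (false≢true (begin
        false                        ≡⟨ xorSum-false (λ u → allFreeOne-zero u (hits≡1⇒∈ R u (hR u))) ⟨
        xorSum (allFreeOne G T f)    ≡⟨ xorSum-allFreeOne G T hT f ⟩
        f · defect G T               ≡⟨ fz ⟩
        true                         ∎))
        where
        allFreeOne-zero : ∀ u → ∃[ s ] (memU R u s ≡ true) → allFreeOne G T f u ≡ false
        allFreeOne-zero u (s , u∈R) = all₃-false (λ t → memU T u t ∨ colDot G f u t) s
          (cong₂ _∨_ (R∩T=∅ u s u∈R) (annihilates⇒orthogonal G ann u s u∈R))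
      spanned : Spanned (colsOf G R) (defect G T) → ∀ r → defect G T r ≡ false
      spanned (J , spans) = by-support (Fin.any? (λ u → any-tag? (λ t → (memU R u t ∧ J u t) Bool.≟ true)))
        where
        by-support : Dec (∃[ u ] ∃[ t ] (memU R u t ∧ J u t ≡ true)) → ∀ r → defect G T r ≡ false
        by-support (yes (u , t₀ , hit)) = ⊥-elim (defect-support⇒¬tight tight R J R∩T=∅ hR ind spans u t₀ hit)
        by-support (no none) r = trans (sym (spans r)) (sumᵤ-false λ i t → begin
          J i t ∧ (memU R i t ∧ col G i t r)   ≡⟨ ∧-lcomm (J i t) (memU R i t) (col G i t r) ⟩
          memU R i t ∧ (J i t ∧ col G i t r)   ≡⟨ ∧-assoc (memU R i t) (J i t) (col G i t r) ⟨
          (memU R i t ∧ J i t) ∧ col G i t r   ≡⟨ cong (_∧ col G i t r) (Bool.¬-not λ e → none (i , t , e)) ⟩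
          false                                ∎)

-- Ort(Z_G)

orthoTag : Bool → Bool → Tag → Bool
orthoTag x a t1 = x
orthoTag x a t2 = not x ∧ a
orthoTag x a t3 = not x ∧ not a

δᵗ≡orthoTag : ∀ s t → δᵗ s t ≡ orthoTag (δᵗ s t1) (δᵗ s t2) t
δᵗ≡orthoTag t1 t1 = refl
δᵗ≡orthoTag t1 t2 = refl
δᵗ≡orthoTag t1 t3 = refl
δᵗ≡orthoTag t2 t1 = refl
δᵗ≡orthoTag t2 t2 = refl
δᵗ≡orthoTag t2 t3 = refl
δᵗ≡orthoTag t3 t1 = refl
δᵗ≡orthoTag t3 t2 = refl
δᵗ≡orthoTag t3 t3 = refl

count₃-orthoTag : ∀ x a → count₃ (orthoTag x a) ≡ 1
count₃-orthoTag true  a     = refl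
count₃-orthoTag false true  = refl
count₃-orthoTag false false = refl

module OrtCharacterisation (G : SimpleGraph n) where

  orthoSet : Subset n → USet n
  orthoSet X = (φ t1 X ∪ᵤ φ t2 (oddG G X)) ∪ᵤ φ t3 (evenG G X)

  memU-orthoSet : ∀ X v t → memU (orthoSet X) v t ≡ orthoTag (lookup X v) (adjSum G (lookup X) v) t
  memU-orthoSet X v t =
    trans (memU-lift₂ _∨_ (φ t1 X ∪ᵤ φ t2 (oddG G X)) (φ t3 (evenG G X)) v t)
    (trans (cong₂ _∨_ (trans (memU-lift₂ _∨_ (φ t1 X) (φ t2 (oddG G X)) v t)
                             (cong₂ _∨_ (memU-φ t1 X v t) (memU-φ t2 (oddG G X) v t)))
                      (memU-φ t3 (evenG G X) v t))
           (by-tag t))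
    where
    by-tag : ∀ t → ((δᵗ t1 t ∧ lookup X v) ∨ (δᵗ t2 t ∧ lookup (oddG G X) v)) ∨ (δᵗ t3 t ∧ lookup (evenG G X) v)
                   ≡ orthoTag (lookup X v) (adjSum G (lookup X) v) t
    by-tag t1 = trans (∨-identityʳ (lookup X v ∨ false)) (∨-identityʳ (lookup X v))
    by-tag t2 = trans (∨-identityʳ (lookup (oddG G X) v)) (lookup-oddG G X v)
    by-tag t3 = lookup-evenG G X v

  transversal-orthoSet : ∀ X → Transversalᵤ (orthoSet X)
  transversal-orthoSet X v = trans (hits≡count₃ (orthoSet X) v)
    (trans (count₃-cong (memU-orthoSet X v)) (count₃-orthoTag (lookup X v) (adjSum G (lookup X) v)))

  defect-orthoSet : ∀ X → Eulerian G X → ∀ r → defect G (orthoSet X) r ≡ false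
  defect-orthoSet X eul r = ≡⇒xor≡false (begin
    adjSum G (λ v → memU (orthoSet X) v t1) r     ≡⟨ adjSum-cong G (λ v → memU-orthoSet X v t1) r ⟩
    adjSum G (lookup X) r                         ≡⟨ not∧≡ (Eulerian⇔ G X .Equivalence.to eul r) ⟨
    not (lookup X r) ∧ adjSum G (lookup X) r      ≡⟨ memU-orthoSet X r t2 ⟨
    memU (orthoSet X) r t2                        ∎)
    where open ≡-Reasoning

  Ort⇐ : ∀ X → Eulerian G X → Ort (Zgraph G) (orthoSet X)
  Ort⇐ X eul = ((λ v t _ → memU-full v t) , (λ v _ → transversal-orthoSet X v)) ,
               Tightness.defect≡0⇒tight G (transversal-orthoSet X) (defect-orthoSet X eul)

  Ort⇒ : ∀ T → Ort (Zgraph G) T → ∃[ X ] (Eulerian G X × T ≡ orthoSet X)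
  Ort⇒ T ((_ , hT′) , tight) = p1 T , eulerian , USet-ext λ v t → trans (per-class v t) (sym (memU-orthoSet (p1 T) v t))
    where
    hT : Transversalᵤ T
    hT v = hT′ v (t1 , memU-full v t1)
    A₁≡T₂ : ∀ r → adjSum G (lookup (p1 T)) r ≡ memU T r t2
    A₁≡T₂ r = xor≡false⇒≡ (Tightness.tight⇒defect≡0 G hT tight r)
    eulerian : Eulerian G (p1 T)
    eulerian = Eulerian⇔ G (p1 T) .Equivalence.from λ v x →
      trans (A₁≡T₂ v) (Bool.¬-not λ y → case hits≡1⇒unique T v (hT v) {t1} {t2} x y of λ ())
    per-class : ∀ v t → memU T v t ≡ orthoTag (lookup (p1 T) v) (adjSum G (lookup (p1 T)) v) t
    per-class v t = from-δ (hits≡1⇒δᵗ T v (hT v))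
      where
      open ≡-Reasoning
      from-δ : ∃[ s ] (∀ t → memU T v t ≡ δᵗ s t) → memU T v t ≡ orthoTag (lookup (p1 T) v) (adjSum G (lookup (p1 T)) v) t
      from-δ (s , T=δ) = begin
        memU T v t                          ≡⟨ T=δ t ⟩
        δᵗ s t                              ≡⟨ δᵗ≡orthoTag s t ⟩
        orthoTag (δᵗ s t1) (δᵗ s t2) t      ≡⟨ cong₂ (λ x a → orthoTag x a t) (sym (T=δ t1)) (trans (sym (T=δ t2)) (sym (A₁≡T₂ v))) ⟩
        orthoTag (memU T v t1) (adjSum G (lookup (p1 T)) v) t ∎

  orthoSet-injective : ∀ {X Y} → orthoSet X ≡ orthoSet Y → X ≡ Y
  orthoSet-injective {X} {Y} e =
    Subset-ext λ v → trans (sym (memU-orthoSet X v t1)) (trans (cong (λ Z → memU Z v t1) e) (memU-orthoSet Y v t1))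

  ort : ∀ T → Ort (Zgraph G) T ⇔ (∃[ X ] (Eulerian G X × T ≡ orthoSet X))
  ort T = mk⇔ (Ort⇒ T) λ { (X , eul , refl) → Ort⇐ X eul }

allSubsets : ∀ n → List (Subset n)
allSubsets zero    = [] ∷ []
allSubsets (suc n) = List.map (true ∷_) (allSubsets n) ++ List.map (false ∷_) (allSubsets n)

∈-allSubsets : (X : Subset n) → X ∈ allSubsets n
∈-allSubsets []          = here refl
∈-allSubsets (true ∷ X)  = ∈-++⁺ˡ (∈-map⁺ (true ∷_) (∈-allSubsets X))
∈-allSubsets {suc n} (false ∷ X) = ∈-++⁺ʳ (List.map (true ∷_) (allSubsets n)) (∈-map⁺ (false ∷_) (∈-allSubsets X))

allSubsets-unique : ∀ n → Unique (allSubsets n)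
allSubsets-unique zero    = All.[] AllPairs.∷ AllPairs.[]
allSubsets-unique (suc n) =
  Unique.++⁺ (Unique.map⁺ ∷-injectiveʳ (allSubsets-unique n)) (Unique.map⁺ ∷-injectiveʳ (allSubsets-unique n)) disjoint
  where
  disjoint : ∀ {X} → ¬ (X ∈ List.map (true ∷_) (allSubsets n) × X ∈ List.map (false ∷_) (allSubsets n))
  disjoint (x∈true , x∈false) with ∈-map⁻ (true ∷_) x∈true | ∈-map⁻ (false ∷_) x∈false
  ... | _ , _ , refl | _ , _ , ()

module Cardinality (G : SimpleGraph n) where

  eulerian? : ∀ X → Dec (Eulerian G X)
  eulerian? X = Fin.all? (λ v → (lookup X v Bool.≟ true) →-dec (nbrCount G X v % 2 Nat.≟ 0))

  eulerianSubsets : List (Subset n)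
  eulerianSubsets = List.filter eulerian? (allSubsets n)

  ∈-eulerianSubsets : ∀ X → X ∈ eulerianSubsets ⇔ Eulerian G X
  ∈-eulerianSubsets X = mk⇔ (λ x∈ → proj₂ (∈-filter⁻ eulerian? {xs = allSubsets n} x∈))
                            (∈-filter⁺ eulerian? (∈-allSubsets X))

  hasCard-Eulerian : HasCard (Eulerian G) (List.length eulerianSubsets)
  hasCard-Eulerian = eulerianSubsets , Unique.filter⁺ eulerian? (allSubsets-unique n) , ∈-eulerianSubsets , refl

  hasCard-image : (P : USet n → Set) (F : Subset n → USet n) → (∀ {X Y} → F X ≡ F Y → X ≡ Y) →
    (∀ Y → P Y ⇔ (∃[ X ] (Eulerian G X × Y ≡ F X))) → HasCard P (List.length eulerianSubsets)
  hasCard-image P F F-injective P⇔image =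
    List.map F eulerianSubsets , Unique.map⁺ F-injective (hasCard-Eulerian .proj₂ .proj₁) , ∈-image , length-map F eulerianSubsets
    where
    ∈-image : ∀ Y → Y ∈ List.map F eulerianSubsets ⇔ P Y
    ∈-image Y = mk⇔
      (λ y∈ → let (X , x∈ , Y≡FX) = ∈-map⁻ F y∈
              in P⇔image Y .Equivalence.from (X , ∈-eulerianSubsets X .Equivalence.to x∈ , Y≡FX))
      (λ pY → let (X , eul , Y≡FX) = P⇔image Y .Equivalence.to pY
              in subst (_∈ List.map F eulerianSubsets) (sym Y≡FX) (∈-map⁺ F (∈-eulerianSubsets X .Equivalence.from eul)))

mainTheorem10 : ∀ {n : ℕ} (G : SimpleGraph n) →
    (∀ (Y : USet n) → CS (Zgraph G −ᵤ φ t3 ⊤) Y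
        ⇔ (∃[ X ] (Eulerian G X × Y ≡ (φ t2 X ∪ᵤ φ t1 (oddG G X)))))
    × (∀ (T : USet n) → Ort (Zgraph G) T
        ⇔ (∃[ X ] (Eulerian G X × T ≡ ((φ t1 X ∪ᵤ φ t2 (oddG G X)) ∪ᵤ φ t3 (evenG G X)))))
    × (∃[ k ] (HasCard (CS (Zgraph G −ᵤ φ t3 ⊤)) k × HasCard (Ort (Zgraph G)) k
        × HasCard (Eulerian G) k))
mainTheorem10 G =
  cycleSpace , ort ,
  List.length eulerianSubsets ,
  hasCard-image (CS Z₁₂) cycleSet cycleSet-injective cycleSpace ,
  hasCard-image (Ort (Zgraph G)) orthoSet orthoSet-injective ort ,
  hasCard-Eulerian
  where
  open CycleSpace G
  open OrtCharacterisation G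
  open Cardinality G
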